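{- Let $D$ be the derivation of $\mathbb{Q}[W,X,Y,Z]$ with $D(W)=WX$, $D(X)=YZ$, $D(Y)=XZ$, $D(Z)=XY$, and define integers $t_{n,i,j}$ by $$D^{2n}(W)=W\sum_{i,j\ge0}t_{2n,i,j}X^{2i}Y^jZ^{2n-2i-j},\qquad D^{2n+1}(W)=W\sum_{i,j\ge0}t_{2n+1,i,j}X^{2i+1}Y^jZ^{2n-2i-j}.$$ Define polynomials $J_n(k^2)=\sum_{0\le 2i\le n-1}J_{n,2i}k^{2i}$ by the Maclaurin expansions of the Jacobi elliptic functions $${\rm sn}(x,k)=\sum_{n\ge0}(-1)^nJ_{2n+1}(k^2)\frac{x^{2n+1}}{(2n+1)!},\qquad {\rm cn}(x,k)=1+\sum_{n\ge0}(-1)^nJ_{2n}(k^2)\frac{x^{2n}}{(2n)!}.$$ Then for $n\ge1$, $J_{n,2i}=t_{n,\lfloor n/2\rfloor-i,0}$.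
   Context: ${\rm sn}(u,k)$ is the inverse in $x$ of $u=F(x,k)=\int_0^x\frac{dt}{\sqrt{(1-t^2)(1-k^2t^2)}}$, and ${\rm cn}(u,k)=\sqrt{1-{\rm sn}^2(u,k)}$, with modulus $k$. -}

module Defs where

open import Data.Nat as ℕ using (ℕ; zero; suc; _∸_; ⌊_/2⌋; _!)
open import Data.Integer using (+_)
open import Data.Rational using (ℚ; 0ℚ; 1ℚ; _+_; _*_; _-_; -_; _/_)
open import Data.Bool using (Bool; true; false; if_then_else_)

nq : ℕ → ℚ
nq n = + n / 1

isOdd : ℕ → Bool
isOdd zero = false
isOdd (suc n) with isOdd n
... | true  = false
... | false = true

sgn : ℕ → ℚ
sgn zero = 1ℚ
sgn (suc n) = - sgn n

sumTo : ℕ → (ℕ → ℚ) → ℚ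
sumTo zero f = f 0
sumTo (suc n) f = sumTo n f + f (suc n)

gbinom : ℚ → ℕ → ℚ
gbinom α zero = 1ℚ
gbinom α (suc a) = gbinom α a * ((α - nq a) * (+ 1 / suc a))

-- Formal power series in x whose coefficients are polynomials in q = k²
-- with rational coefficients.  A polynomial in q is given by its
-- coefficient function, a series by the function n ↦ [x^n].

P : Set
P = ℕ → ℚ

Series : Set
Series = ℕ → P

constP : ℚ → P
constP c zero = c
constP c (suc m) = 0ℚ

pmul : P → P → P
pmul f g m = sumTo m (λ j → f j * g (m ∸ j))

smul : Series → Series → Series
smul f g n m = sumTo n (λ j → pmul (f j) (g (n ∸ j)) m)

sadd : Series → Series → Series
sadd f g n m = f n m + g n m

sneg : Series → Series
sneg f n m = - f n m

oneS : Series
oneS zero = constP 1ℚ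
oneS (suc n) = constP 0ℚ

xS : Series
xS zero = constP 0ℚ
xS (suc zero) = constP 1ℚ
xS (suc (suc n)) = constP 0ℚ

spow : Series → ℕ → Series
spow g zero = oneS
spow g (suc r) = smul g (spow g r)

-- composition  F ∘ g  (meaningful when g has zero constant term, so that
-- [x^n] (F ∘ g) = Σ_{r ≤ n} F_r [x^n] g^r)
compose : Series → Series → Series
compose F g n m = sumTo n (λ r → pmul (F r) (spow g r n) m)

-- (1 + h)^α := Σ_r (α choose r) h^r   (h with zero constant term)
binomPow : ℚ → Series → Series
binomPow α h = compose (λ r → constP (gbinom α r)) h

-- The elliptic integral  F(x,k) = ∫_0^x dt / sqrt((1-t²)(1-k²t²))
-- as a formal power series in x with coefficients in ℚ[k²].

h₁ : Series
h₁ 2 = constP (- 1ℚ)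
h₁ _ = constP 0ℚ

-- -k² t²
h₂ : Series
h₂ 2 = λ { 1 → - 1ℚ ; _ → 0ℚ }
h₂ _ = constP 0ℚ

half : ℚ
half = + 1 / 2

integrand : Series
integrand = smul (binomPow (- half) h₁) (binomPow (- half) h₂)

integ : Series → Series
integ f zero m = 0ℚ
integ f (suc n) m = f n m * (+ 1 / suc n)

ellF : Series
ellF = integ integrand

-- Iteration  g₀ = 0,  g_{r+1} = g_r + (x - F ∘ g_r); since F = x + O(x³),
-- g_r agrees with the inverse series up to order x^r (at least), so the
-- coefficient of x^n of the inverse is that of g_n.

invIter : Series → ℕ → Series
invIter F zero = λ _ → constP 0ℚ
invIter F (suc r) = sadd (invIter F r) (sadd xS (sneg (compose F (invIter F r))))

sinverse : Series → Series
sinverse F n = invIter F n n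

snS : Series
snS = sinverse ellF

-- cn = sqrt(1 - sn²) = (1 + (-sn²))^{1/2}  (the root with constant term 1)
cnS : Series
cnS = binomPow half (sneg (smul snS snS))

-- J_{n,2i}: coefficient of k^{2i} in J_n(k²), read off from
--   sn = Σ (-1)^N J_{2N+1}(k²) x^{2N+1}/(2N+1)!
--   cn = 1 + Σ (-1)^N J_{2N}(k²) x^{2N}/(2N)!
-- (the argument i stands for the exponent 2i, i.e. J n i = J_{n,2i}).
J : ℕ → ℕ → ℚ
J n i = sgn ⌊ n /2⌋ * (nq (n !) * (if isOdd n then snS n i else cnS n i))

-- Polynomials in ℚ[W,X,Y,Z]: coefficient of W^a X^b Y^c Z^d.

Poly4 : Set
Poly4 = ℕ → ℕ → ℕ → ℕ → ℚ

-- contributions of D(W) = WX, D(X) = YZ, D(Y) = XZ, D(Z) = XY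
dW dX dY dZ : Poly4 → Poly4
dW p a zero c d = 0ℚ
dW p a (suc b) c d = nq a * p a b c d
dX p a b (suc c) (suc d) = nq (suc b) * p a (suc b) c d
dX p a b _ _ = 0ℚ
dY p a (suc b) c (suc d) = nq (suc c) * p a b (suc c) d
dY p a _ _ _ = 0ℚ
dZ p a (suc b) (suc c) d = nq (suc d) * p a b c (suc d)
dZ p a _ _ _ = 0ℚ

D : Poly4 → Poly4
D p a b c d = dW p a b c d + (dX p a b c d + (dY p a b c d + dZ p a b c d))

Dpow : ℕ → Poly4 → Poly4
Dpow zero p = p
Dpow (suc n) p = D (Dpow n p)

Wpoly : Poly4
Wpoly 1 0 0 0 = 1ℚ
Wpoly _ _ _ _ = 0ℚ

t : ℕ → ℕ → ℕ → ℚ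
t n i j = Dpow n Wpoly 1 (if isOdd n then suc (2 ℕ.* i) else 2 ℕ.* i) j
            (2 ℕ.* ⌊ n /2⌋ ∸ 2 ℕ.* i ∸ j)

module Submission where

-- With q = k², sn is the compositional inverse of F(x) = ∫₀ˣ (1 − t²)^(−1/2) (1 − q t²)^(−1/2) dt,
-- and cn = (1 − sn²)^(1/2), dn = (1 − q sn²)^(1/2) satisfy sn′ = cn dn, cn′ = −sn dn,
-- dn′ = −q sn cn; all of this is derived for formal power series over ℚ[[q]], the binomial
-- series (1 + x)^(±1/2) being characterised by their differential equations.  The substitution
-- x ↦ ix turns Y = sn(ix)/i, Z = cn(ix), X = dn(ix) into a solution of Y′ = XZ, Z′ = XY,
-- X′ = qYZ, and W = Z + Y solves W′ = XW.  These are the rules of D after scaling Y and Z by √q,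
-- so n! Wₙ is Dⁿ(W) evaluated at W = X = Z = 1, Y = 0 with weight q^⌊d/2⌋ on Z^d.  Its
-- coefficient of q^i counts the monomial W X^(n−2i) Z^(2i), i.e. it is t_{n,⌊n/2⌋−i,0}, while
-- n! Wₙ = (−1)^⌊n/2⌋ n! [xⁿ](cn + sn) = J_n(q).

open import Algebra.Bundles using (CommutativeRing)
open import Data.Empty using (⊥-elim)
open import Data.List as List using (List; []; _∷_; _++_; replicate; concatMap)
open import Data.Nat as ℕ using (ℕ; zero; suc; _∸_; _≤_; _<_; z≤n; s≤s; ⌊_/2⌋; parity)
open import Data.Parity.Base as ℙ using (Parity; 0ℙ; 1ℙ; _⁻¹)
open import Function using (_∘_)
open import Level using (_⊔_; 0ℓ)
import Relation.Binary.PropositionalEquality as ≡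
open import Relation.Binary.PropositionalEquality using (_≢_)


∸-<-shift : ∀ a {b j n} → a ≤ j → j ≤ n → n < a ℕ.+ b → n ∸ j < b
∸-<-shift zero    {j = zero}  _         _         n<b         = n<b
∸-<-shift zero    {j = suc j} _         (s≤s j≤n) n<b         = <-trans (s≤s (m∸n≤m _ j)) n<b
  where open import Data.Nat.Properties using (<-trans; m∸n≤m)
∸-<-shift (suc a) (s≤s a≤j) (s≤s j≤n) (s≤s n<a+b) = ∸-<-shift a a≤j j≤n n<a+b

-- The stdlib ring solver needs a coefficient ring with decidable equality; we use ℤ,
-- interpreted in an arbitrary commutative ring R via i ↦ i · 1#.
module RingSolver {c ℓ} (R : CommutativeRing c ℓ) where
  open CommutativeRing R
  open import Algebra.Properties.Ring ring using (-‿involutive; -0#≈0#; -‿+-comm; -‿distribˡ-*; -‿distribʳ-*)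
  open import Algebra.Properties.Semiring.Mult.TCOptimised semiring using (_×_; ×-homo-+; ×1-homo-*)
  open import Algebra.Solver.Ring.AlmostCommutativeRing
    using (fromCommutativeRing; _-Raw-AlmostCommutative⟶_)
  open import Data.Integer as ℤ using (ℤ; +_; -[1+_]; _⊖_)
  import Data.Integer.Properties as ℤ
  import Data.Nat.Properties as ℕ
  open import Data.Maybe using (Maybe; just; nothing)
  open import Relation.Nullary using (yes; no)
  open import Relation.Binary.Reasoning.Setoid setoid

  private
    ⟦_⟧ℤ : ℤ → Carrier
    ⟦ + n      ⟧ℤ = n × 1#
    ⟦ -[1+ n ] ⟧ℤ = - (suc n × 1#)

    1+-cancel : ∀ a b → (1# + a) - (1# + b) ≈ a - b
    1+-cancel a b = begin
      (1# + a) - (1# + b)       ≈⟨ +-cong refl (-‿+-comm 1# b) ⟨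
      (1# + a) + (- 1# + - b)   ≈⟨ +-assoc 1# a _ ⟩
      1# + (a + (- 1# + - b))   ≈⟨ +-cong refl (x∙yz≈y∙xz a (- 1#) (- b)) ⟩
      1# + (- 1# + (a - b))     ≈⟨ +-assoc 1# (- 1#) _ ⟨
      (1# - 1#) + (a - b)       ≈⟨ +-cong (-‿inverseʳ 1#) refl ⟩
      0# + (a - b)              ≈⟨ +-identityˡ _ ⟩
      a - b                     ∎
      where open import Algebra.Properties.CommutativeSemigroup +-commutativeSemigroup using (x∙yz≈y∙xz)

    ⊖-homo : ∀ m n → ⟦ m ⊖ n ⟧ℤ ≈ m × 1# - n × 1#
    ⊖-homo m       zero    = sym (trans (+-cong refl -0#≈0#) (+-identityʳ _))
    ⊖-homo zero    (suc n) = sym (+-identityˡ _)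
    ⊖-homo (suc m) (suc n) = begin
      ⟦ suc m ⊖ suc n ⟧ℤ         ≡⟨ ≡.cong ⟦_⟧ℤ (ℤ.[1+m]⊖[1+n]≡m⊖n m n) ⟩
      ⟦ m ⊖ n ⟧ℤ                 ≈⟨ ⊖-homo m n ⟩
      m × 1# - n × 1#           ≈⟨ 1+-cancel _ _ ⟨
      (1# + m × 1#) - (1# + n × 1#)
                                ≈⟨ +-cong (×-homo-+ 1# 1 m) (-‿cong (×-homo-+ 1# 1 n)) ⟨
      suc m × 1# - suc n × 1#   ∎

    neg-homo : ∀ i → ⟦ ℤ.- i ⟧ℤ ≈ - ⟦ i ⟧ℤ
    neg-homo -[1+ n ]    = sym (-‿involutive _)
    neg-homo (+ zero)    = sym -0#≈0#
    neg-homo (+ suc n)   = refl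

    +-homo : ∀ i j → ⟦ i ℤ.+ j ⟧ℤ ≈ ⟦ i ⟧ℤ + ⟦ j ⟧ℤ
    +-homo -[1+ m ] -[1+ n ] = begin
      - (suc (suc (m ℕ.+ n)) × 1#)    ≡⟨ ≡.cong (λ k → - (suc k × 1#)) (ℕ.+-suc m n) ⟨
      - ((suc m ℕ.+ suc n) × 1#)      ≈⟨ -‿cong (×-homo-+ 1# (suc m) (suc n)) ⟩
      - (suc m × 1# + suc n × 1#)     ≈⟨ -‿+-comm _ _ ⟨
      ⟦ -[1+ m ] ⟧ℤ + ⟦ -[1+ n ] ⟧ℤ     ∎
    +-homo -[1+ m ] (+ n)    = trans (⊖-homo n (suc m)) (+-comm _ _)
    +-homo (+ m)    -[1+ n ] = ⊖-homo m (suc n)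
    +-homo (+ m)    (+ n)    = ×-homo-+ 1# m n

    *-homo-+ : ∀ m j → ⟦ + m ℤ.* j ⟧ℤ ≈ ⟦ + m ⟧ℤ * ⟦ j ⟧ℤ
    *-homo-+ m (+ n)    = trans (reflexive (≡.cong ⟦_⟧ℤ (≡.sym (ℤ.pos-* m n)))) (×1-homo-* m n)
    *-homo-+ m -[1+ n ] = begin
      ⟦ + m ℤ.* -[1+ n ] ⟧ℤ            ≡⟨ ≡.cong ⟦_⟧ℤ (ℤ.neg-distribʳ-* (+ m) (+ suc n)) ⟨
      ⟦ ℤ.- (+ m ℤ.* + suc n) ⟧ℤ       ≈⟨ neg-homo (+ m ℤ.* + suc n) ⟩
      - ⟦ + m ℤ.* + suc n ⟧ℤ           ≈⟨ -‿cong (*-homo-+ m (+ suc n)) ⟩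
      - (m × 1# * suc n × 1#)         ≈⟨ -‿distribʳ-* _ _ ⟩
      m × 1# * - (suc n × 1#)         ∎

    *-homo : ∀ i j → ⟦ i ℤ.* j ⟧ℤ ≈ ⟦ i ⟧ℤ * ⟦ j ⟧ℤ
    *-homo (+ m)    j = *-homo-+ m j
    *-homo -[1+ m ] j = begin
      ⟦ -[1+ m ] ℤ.* j ⟧ℤ              ≡⟨ ≡.cong ⟦_⟧ℤ (ℤ.neg-distribˡ-* (+ suc m) j) ⟨
      ⟦ ℤ.- (+ suc m ℤ.* j) ⟧ℤ         ≈⟨ neg-homo (+ suc m ℤ.* j) ⟩
      - ⟦ + suc m ℤ.* j ⟧ℤ             ≈⟨ -‿cong (*-homo-+ (suc m) j) ⟩
      - (suc m × 1# * ⟦ j ⟧ℤ)          ≈⟨ -‿distribˡ-* _ _ ⟩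
      ⟦ -[1+ m ] ⟧ℤ * ⟦ j ⟧ℤ            ∎

    ℤ⟶R : ℤ.+-*-rawRing -Raw-AlmostCommutative⟶ fromCommutativeRing R
    ℤ⟶R = record
      { ⟦_⟧ = ⟦_⟧ℤ ; +-homo = +-homo ; *-homo = *-homo ; -‿homo = neg-homo ; 0-homo = refl ; 1-homo = refl }

    ⟦⟧-≟ : ∀ i j → Maybe (⟦ i ⟧ℤ ≈ ⟦ j ⟧ℤ)
    ⟦⟧-≟ i j with i ℤ.≟ j
    ... | yes i≡j = just (reflexive (≡.cong ⟦_⟧ℤ i≡j))
    ... | no  _   = nothing

  open import Algebra.Solver.Ring ℤ.+-*-rawRing (fromCommutativeRing R) ℤ⟶R ⟦⟧-≟ public
    using (solve; _:=_; _:+_; _:*_; :-_; _:-_; con)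

module FiniteSums {c ℓ} (R : CommutativeRing c ℓ) where
  open CommutativeRing R
  open import Algebra.Properties.CommutativeSemigroup +-commutativeSemigroup using (interchange)
  open import Algebra.Properties.Ring ring using (-‿+-comm)
  open import Algebra.Properties.Semiring.Mult semiring using (_×_)
  open import Algebra.Properties.CommutativeMonoid.Mult +-commutativeMonoid using (×-distrib-+)
  open import Data.Nat.Properties
    using (≤-refl; m≤n⇒m≤1+n; m≤n⇒m<n∨m≡n; n∸n≡0; +-∸-assoc)
  open import Data.Sum using (inj₁; inj₂)
  open import Relation.Binary.Reasoning.Setoid setoid

  -- ∑ n f = f 0 + ⋯ + f n, with n + 1 terms (the same convention as sumTo in Defs).
  ∑ : ℕ → (ℕ → Carrier) → Carrier
  ∑ zero    f = f 0
  ∑ (suc n) f = ∑ n f + f (suc n)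

  ∑-cong≤ : ∀ n {f g : ℕ → Carrier} → (∀ {i} → i ≤ n → f i ≈ g i) → ∑ n f ≈ ∑ n g
  ∑-cong≤ zero    f≈g = f≈g z≤n
  ∑-cong≤ (suc n) f≈g = +-cong (∑-cong≤ n (λ i≤n → f≈g (m≤n⇒m≤1+n i≤n))) (f≈g ≤-refl)

  ∑-cong : ∀ n {f g : ℕ → Carrier} → (∀ i → f i ≈ g i) → ∑ n f ≈ ∑ n g
  ∑-cong n f≈g = ∑-cong≤ n (λ {i} _ → f≈g i)

  ∑-distrib-+ : ∀ n (f g : ℕ → Carrier) → ∑ n (λ i → f i + g i) ≈ ∑ n f + ∑ n g
  ∑-distrib-+ zero    f g = refl
  ∑-distrib-+ (suc n) f g = trans (+-cong (∑-distrib-+ n f g) refl) (interchange _ _ _ _)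

  ∑-neg : ∀ n (f : ℕ → Carrier) → ∑ n (λ i → - f i) ≈ - ∑ n f
  ∑-neg zero    f = refl
  ∑-neg (suc n) f = trans (+-cong (∑-neg n f) refl) (-‿+-comm _ _)

  *-distribˡ-∑ : ∀ n a (f : ℕ → Carrier) → a * ∑ n f ≈ ∑ n (λ i → a * f i)
  *-distribˡ-∑ zero    a f = refl
  *-distribˡ-∑ (suc n) a f = trans (distribˡ a _ _) (+-cong (*-distribˡ-∑ n a f) refl)

  *-distribʳ-∑ : ∀ n a (f : ℕ → Carrier) → ∑ n f * a ≈ ∑ n (λ i → f i * a)
  *-distribʳ-∑ zero    a f = refl
  *-distribʳ-∑ (suc n) a f = trans (distribʳ a _ _) (+-cong (*-distribʳ-∑ n a f) refl)

  ×-distrib-∑ : ∀ k n (f : ℕ → Carrier) → k × ∑ n f ≈ ∑ n (λ i → k × f i)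
  ×-distrib-∑ k zero    f = refl
  ×-distrib-∑ k (suc n) f = trans (×-distrib-+ _ _ k) (+-cong (×-distrib-∑ k n f) refl)

  ∑-zero : ∀ n {f : ℕ → Carrier} → (∀ {i} → i ≤ n → f i ≈ 0#) → ∑ n f ≈ 0#
  ∑-zero zero    f≈0 = f≈0 z≤n
  ∑-zero (suc n) f≈0 =
    trans (+-cong (∑-zero n (λ i≤n → f≈0 (m≤n⇒m≤1+n i≤n))) (f≈0 ≤-refl)) (+-identityˡ 0#)

  ∑-truncate : ∀ {n N} {f : ℕ → Carrier} → n ≤ N →
               (∀ {i} → n < i → i ≤ N → f i ≈ 0#) → ∑ N f ≈ ∑ n f
  ∑-truncate {N = zero}  z≤n  _   = refl
  ∑-truncate {N = suc N} n≤1+N f≈0 with m≤n⇒m<n∨m≡n n≤1+N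
  ... | inj₂ ≡.refl     = refl
  ... | inj₁ (s≤s n≤N) = trans (+-cong (∑-truncate n≤N (λ n<i i≤N → f≈0 n<i (m≤n⇒m≤1+n i≤N)))
                                        (f≈0 (s≤s n≤N) ≤-refl))
                                (+-identityʳ _)

  ∑-suc : ∀ n (f : ℕ → Carrier) → ∑ (suc n) f ≈ f 0 + ∑ n (λ i → f (suc i))
  ∑-suc zero    f = refl
  ∑-suc (suc n) f = trans (+-cong (∑-suc n f) refl) (+-assoc _ _ _)

  ∑-comm : ∀ n m (f : ℕ → ℕ → Carrier) →
           ∑ n (λ i → ∑ m (λ j → f i j)) ≈ ∑ m (λ j → ∑ n (λ i → f i j))
  ∑-comm zero    m f = refl
  ∑-comm (suc n) m f = trans (+-cong (∑-comm n m f) refl) (sym (∑-distrib-+ m _ _))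

  ∑-reverse : ∀ n (f : ℕ → Carrier) → ∑ n f ≈ ∑ n (λ i → f (n ∸ i))
  ∑-reverse zero    f = refl
  ∑-reverse (suc n) f =
    trans (+-cong (∑-reverse n f) refl) (trans (+-comm _ _) (sym (∑-suc n (λ i → f (suc n ∸ i)))))

  ∑-triangle : ∀ n (f : ℕ → ℕ → Carrier) →
               ∑ n (λ k → ∑ k (λ i → f i (k ∸ i))) ≈ ∑ n (λ i → ∑ (n ∸ i) (λ j → f i j))
  ∑-triangle zero    f = refl
  ∑-triangle (suc n) f = begin
    ∑ n (λ k → ∑ k (λ i → f i (k ∸ i))) + ∑ (suc n) (λ i → f i (suc n ∸ i))
      ≈⟨ +-cong (∑-triangle n f) refl ⟩
    ∑ n (λ i → ∑ (n ∸ i) (f i)) + (∑ n (λ i → f i (suc n ∸ i)) + f (suc n) (n ∸ n))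
      ≈⟨ +-assoc _ _ _ ⟨
    (∑ n (λ i → ∑ (n ∸ i) (f i)) + ∑ n (λ i → f i (suc n ∸ i))) + f (suc n) (n ∸ n)
      ≈⟨ +-cong (sym (∑-distrib-+ n _ _)) (reflexive (≡.cong (f (suc n)) (n∸n≡0 n))) ⟩
    ∑ n (λ i → ∑ (n ∸ i) (f i) + f i (suc n ∸ i)) + f (suc n) 0
      ≈⟨ +-cong (∑-cong≤ n row) refl ⟩
    ∑ n (λ i → ∑ (suc n ∸ i) (f i)) + ∑ 0 (f (suc n))
      ≡⟨ ≡.cong (λ k → ∑ n (λ i → ∑ (suc n ∸ i) (f i)) + ∑ k (f (suc n))) (n∸n≡0 n) ⟨
    ∑ (suc n) (λ i → ∑ (suc n ∸ i) (f i)) ∎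
    where
    row : ∀ {i} → i ≤ n → ∑ (n ∸ i) (f i) + f i (suc n ∸ i) ≈ ∑ (suc n ∸ i) (f i)
    row i≤n rewrite +-∸-assoc 1 i≤n = refl

module PowerSeries {c ℓ} (R : CommutativeRing c ℓ) where
  open CommutativeRing R
  open FiniteSums R
  open import Algebra.Structures using (IsCommutativeRing)
  open import Algebra.Properties.Ring ring using (-0#≈0#)
  open import Data.Nat using (_<?_)
  open import Data.Nat.Properties using (m∸[m∸n]≡n; ∸-+-assoc; m+[n∸m]≡n; <-≤-trans; ≮⇒≥)
  open import Relation.Nullary using (yes; no)
  open import Data.Product using (_,_)
  open import Relation.Binary.Bundles using (Setoid)
  open import Relation.Binary.Structures using (IsEquivalence)
  import Relation.Binary.Reasoning.Setoid as SetoidReasoning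
  open SetoidReasoning setoid

  Series : Set c
  Series = ℕ → Carrier

  infix 4 _≋_
  record _≋_ (f g : Series) : Set ℓ where
    constructor coeffwise
    field coeff : ∀ n → f n ≈ g n
  open _≋_ public

  infixl 6 _⊞_
  infixl 7 _⊠_
  infix  8 ⊟_

  _⊞_ : Series → Series → Series
  (f ⊞ g) n = f n + g n

  ⊟_ : Series → Series
  (⊟ f) n = - f n

  _⊠_ : Series → Series → Series
  (f ⊠ g) n = ∑ n (λ j → f j * g (n ∸ j))

  const : Carrier → Series
  const a zero    = a
  const a (suc n) = 0#

  𝟘 𝟙 𝕏 : Series
  𝟘 _ = 0#
  𝟙 = const 1#
  𝕏 zero          = 0#
  𝕏 (suc zero)    = 1#
  𝕏 (suc (suc n)) = 0#

  ≋-isEquivalence : IsEquivalence _≋_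
  ≋-isEquivalence = record
    { refl  = coeffwise (λ _ → refl)
    ; sym   = λ f≋g → coeffwise (λ n → sym (coeff f≋g n))
    ; trans = λ f≋g g≋h → coeffwise (λ n → trans (coeff f≋g n) (coeff g≋h n))
    }

  ≋-setoid : Setoid c ℓ
  ≋-setoid = record { isEquivalence = ≋-isEquivalence }

  module ≋-Reasoning = SetoidReasoning ≋-setoid

  ∑-const : ∀ n a (f : ℕ → Carrier) → ∑ n (λ i → const a i * f i) ≈ a * f 0
  ∑-const zero    a f = refl
  ∑-const (suc n) a f = begin
    ∑ (suc n) (λ i → const a i * f i)      ≈⟨ ∑-suc n _ ⟩
    a * f 0 + ∑ n (λ i → 0# * f (suc i))   ≈⟨ +-cong refl (∑-zero n (λ _ → zeroˡ _)) ⟩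
    a * f 0 + 0#                           ≈⟨ +-identityʳ _ ⟩
    a * f 0                                ∎

  ∑-𝕏 : ∀ n (f : ℕ → Carrier) → ∑ (suc n) (λ i → 𝕏 i * f i) ≈ f 1
  ∑-𝕏 n f = begin
    ∑ (suc n) (λ i → 𝕏 i * f i)                 ≈⟨ ∑-suc n _ ⟩
    0# * f 0 + ∑ n (λ i → 𝕏 (suc i) * f (suc i)) ≈⟨ +-cong (zeroˡ _) (∑-truncate z≤n 𝕏-vanishes) ⟩
    0# + 1# * f 1                               ≈⟨ +-identityˡ _ ⟩
    1# * f 1                                    ≈⟨ *-identityˡ _ ⟩
    f 1                                         ∎
    where
    𝕏-vanishes : ∀ {i} → 0 < i → i ≤ n → 𝕏 (suc i) * f (suc i) ≈ 0#
    𝕏-vanishes {suc i} _ _ = zeroˡ _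

  const-⊠ : ∀ a f n → (const a ⊠ f) n ≈ a * f n
  const-⊠ a f n = ∑-const n a (λ j → f (n ∸ j))

  ⊠-comm : ∀ f g n → (f ⊠ g) n ≈ (g ⊠ f) n
  ⊠-comm f g n = trans (∑-reverse n _)
    (∑-cong≤ n (λ j≤n → trans (*-comm _ _) (*-cong (reflexive (≡.cong g (m∸[m∸n]≡n j≤n))) refl)))

  ⊠-identityʳ : ∀ f n → (f ⊠ 𝟙) n ≈ f n
  ⊠-identityʳ f n = trans (⊠-comm f 𝟙 n) (trans (const-⊠ 1# f n) (*-identityˡ _))

  ⊠-assoc : ∀ f g h n → ((f ⊠ g) ⊠ h) n ≈ (f ⊠ (g ⊠ h)) n
  ⊠-assoc f g h n = begin
    ∑ n (λ k → ∑ k (λ i → f i * g (k ∸ i)) * h (n ∸ k))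
      ≈⟨ ∑-cong n (λ k → *-distribʳ-∑ k _ _) ⟩
    ∑ n (λ k → ∑ k (λ i → (f i * g (k ∸ i)) * h (n ∸ k)))
      ≈⟨ ∑-cong n (λ k → ∑-cong≤ k (λ i≤k → trans (*-assoc _ _ _) (*-cong refl (*-cong refl (h-index i≤k))))) ⟩
    ∑ n (λ k → ∑ k (λ i → F i (k ∸ i)))
      ≈⟨ ∑-triangle n F ⟩
    ∑ n (λ i → ∑ (n ∸ i) (λ j → F i j))
      ≈⟨ ∑-cong n (λ i → *-distribˡ-∑ (n ∸ i) _ _) ⟨
    (f ⊠ (g ⊠ h)) n ∎
    where
    F : ℕ → ℕ → Carrier
    F i j = f i * (g j * h (n ∸ i ∸ j))
    h-index : ∀ {i k} → i ≤ k → h (n ∸ k) ≈ h (n ∸ i ∸ (k ∸ i))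
    h-index {i} {k} i≤k =
      reflexive (≡.cong h (≡.sym (≡.trans (∸-+-assoc n i (k ∸ i)) (≡.cong (n ∸_) (m+[n∸m]≡n i≤k)))))

  ⊠-cong : ∀ {f f′ g g′} → f ≋ f′ → g ≋ g′ → f ⊠ g ≋ f′ ⊠ g′
  ⊠-cong f≋f′ g≋g′ = coeffwise (λ n → ∑-cong n (λ j → *-cong (coeff f≋f′ j) (coeff g≋g′ (n ∸ j))))

  ⊠-congˡ : ∀ h {f g} → f ≋ g → h ⊠ f ≋ h ⊠ g
  ⊠-congˡ h f≋g = ⊠-cong (IsEquivalence.refl ≋-isEquivalence {h}) f≋g

  ⊠-congʳ : ∀ h {f g} → f ≋ g → f ⊠ h ≋ g ⊠ h
  ⊠-congʳ h f≋g = ⊠-cong f≋g (IsEquivalence.refl ≋-isEquivalence {h})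

  ⊞-cong : ∀ {f f′ g g′} → f ≋ f′ → g ≋ g′ → f ⊞ g ≋ f′ ⊞ g′
  ⊞-cong f≋f′ g≋g′ = coeffwise (λ n → +-cong (coeff f≋f′ n) (coeff g≋g′ n))

  ⊞-congˡ : ∀ h {f g} → f ≋ g → h ⊞ f ≋ h ⊞ g
  ⊞-congˡ h f≋g = coeffwise (λ n → +-cong refl (coeff f≋g n))

  ⊞-congʳ : ∀ h {f g} → f ≋ g → f ⊞ h ≋ g ⊞ h
  ⊞-congʳ h f≋g = coeffwise (λ n → +-cong (coeff f≋g n) refl)

  ⊟-cong : ∀ {f g} → f ≋ g → ⊟ f ≋ ⊟ g
  ⊟-cong f≋g = coeffwise (λ n → -‿cong (coeff f≋g n))

  const-cong : ∀ {a b} → a ≈ b → const a ≋ const b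
  const-cong a≈b = coeffwise λ { zero → a≈b ; (suc n) → refl }

  const-+ : ∀ a b → const (a + b) ≋ const a ⊞ const b
  const-+ a b = coeffwise λ { zero → refl ; (suc n) → sym (+-identityˡ 0#) }

  powerSeries-isCommutativeRing : IsCommutativeRing _≋_ _⊞_ _⊠_ ⊟_ 𝟘 𝟙
  powerSeries-isCommutativeRing = record
    { isRing = record
      { +-isAbelianGroup = record
        { isGroup = record
          { isMonoid = record
            { isSemigroup = record
              { isMagma = record
                { isEquivalence = ≋-isEquivalence
                ; ∙-cong = ⊞-cong }
              ; assoc = λ f g h → coeffwise (λ n → +-assoc _ _ _) }
            ; identity = (λ f → coeffwise (λ n → +-identityˡ _))
                       , (λ f → coeffwise (λ n → +-identityʳ _)) }
          ; inverse = (λ f → coeffwise (λ n → -‿inverseˡ _)) , (λ f → coeffwise (λ n → -‿inverseʳ _))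
          ; ⁻¹-cong = ⊟-cong }
        ; comm = λ f g → coeffwise (λ n → +-comm _ _) }
      ; *-cong = ⊠-cong
      ; *-assoc = λ f g h → coeffwise (⊠-assoc f g h)
      ; *-identity = (λ f → coeffwise (λ n → trans (const-⊠ 1# f n) (*-identityˡ _)))
                   , (λ f → coeffwise (⊠-identityʳ f))
      ; distrib = (λ f g h → coeffwise (λ n → trans (∑-cong n (λ j → distribˡ _ _ _)) (∑-distrib-+ n _ _)))
                , (λ f g h → coeffwise (λ n → trans (∑-cong n (λ j → distribʳ _ _ _)) (∑-distrib-+ n _ _))) }
    ; *-comm = λ f g → coeffwise (⊠-comm f g) }

  powerSeriesRing : CommutativeRing c ℓ
  powerSeriesRing = record { isCommutativeRing = powerSeries-isCommutativeRing }

  𝕏-⊠-suc : ∀ f n → (𝕏 ⊠ f) (suc n) ≈ f n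
  𝕏-⊠-suc f n = ∑-𝕏 n (λ j → f (suc n ∸ j))

  𝕏-⊠-zero : ∀ f → (𝕏 ⊠ f) 0 ≈ 0#
  𝕏-⊠-zero f = zeroˡ _

  Ord≥ : ℕ → Series → Set ℓ
  Ord≥ k f = ∀ {n} → n < k → f n ≈ 0#

  𝕏-Ord≥1 : Ord≥ 1 𝕏
  𝕏-Ord≥1 (s≤s z≤n) = refl

  Ord≥-mono : ∀ {j k f} → j ≤ k → Ord≥ k f → Ord≥ j f
  Ord≥-mono j≤k f≥k n<j = f≥k (<-≤-trans n<j j≤k)

  Ord≥-⊟ : ∀ {k f} → Ord≥ k f → Ord≥ k (⊟ f)
  Ord≥-⊟ f≥k n<k = trans (-‿cong (f≥k n<k)) -0#≈0#

  Ord≥-⊠ : ∀ a b {f g} → Ord≥ a f → Ord≥ b g → Ord≥ (a ℕ.+ b) (f ⊠ g)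
  Ord≥-⊠ a b {f} {g} f≥a g≥b {n} n<a+b = ∑-zero n term≈0
    where
    term≈0 : ∀ {j} → j ≤ n → f j * g (n ∸ j) ≈ 0#
    term≈0 {j} j≤n with j <? a
    ... | yes j<a = trans (*-cong (f≥a j<a) refl) (zeroˡ _)
    ... | no  j≮a = trans (*-cong refl (g≥b (∸-<-shift a (≮⇒≥ j≮a) j≤n n<a+b))) (zeroʳ _)

  open import Algebra.Properties.Semiring.Mult semiring using (_×_)
  open import Algebra.Properties.Semiring.Mult (CommutativeRing.semiring powerSeriesRing) public
    using () renaming (_×_ to _×ₛ_)

  ×ₛ-coeff : ∀ k f n → (k ×ₛ f) n ≈ k × f n
  ×ₛ-coeff zero    f n = refl
  ×ₛ-coeff (suc k) f n = +-cong refl (×ₛ-coeff k f n)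

module Composition {c ℓ} (R : CommutativeRing c ℓ) where
  open CommutativeRing R
  open FiniteSums R
  open PowerSeries R
  open import Algebra.Properties.Ring ring using (-‿distribˡ-*; -0#≈0#)
  open import Data.Nat.Properties using (≤-refl; ≤-trans; ≤-pred; m≤n⇒m<n∨m≡n; m∸n≤m; ≤-<-trans; m+[n∸m]≡n; +-monoʳ-<; ≮⇒≥; m≤n+m)
  open import Data.Nat using (_<?_)
  open import Data.Sum using (inj₁; inj₂)
  open import Relation.Nullary using (yes; no)
  open import Relation.Binary.Reasoning.Setoid setoid

  private module S = CommutativeRing powerSeriesRing
  open import Algebra.Properties.Semiring.Exp S.semiring public using (_^_; ^-congˡ; ^-homo-*)

  -- comp F g is F ∘ g = ∑ᵣ F r gʳ; truncating the sum at r = n is exact for Ord≥ 1 g.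
  comp : Series → Series → Series
  comp F g n = ∑ n (λ r → F r * (g ^ r) n)

  Ord≥-^ : ∀ r {g} → Ord≥ 1 g → Ord≥ r (g ^ r)
  Ord≥-^ zero    g≥1 ()
  Ord≥-^ (suc r) g≥1 = Ord≥-⊠ 1 r g≥1 (Ord≥-^ r g≥1)

  comp-extend : ∀ {F g} → Ord≥ 1 g → ∀ {n N} → n ≤ N → comp F g n ≈ ∑ N (λ r → F r * (g ^ r) n)
  comp-extend g≥1 n≤N = sym (∑-truncate n≤N (λ n<r _ → trans (*-cong refl (Ord≥-^ _ g≥1 n<r)) (zeroʳ _)))

  comp-cong : ∀ {F F′ g g′} → F ≋ F′ → g ≋ g′ → comp F g ≋ comp F′ g′
  comp-cong F≋F′ g≋g′ = coeffwise λ n → ∑-cong n (λ r → *-cong (coeff F≋F′ r) (coeff (^-congˡ r g≋g′) n))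

  comp-0 : ∀ F g → comp F g 0 ≈ F 0
  comp-0 F g = *-identityʳ _

  comp-⊞ : ∀ F G g → comp (F ⊞ G) g ≋ comp F g ⊞ comp G g
  comp-⊞ F G g = coeffwise λ n → trans (∑-cong n (λ r → distribʳ _ _ _)) (∑-distrib-+ n _ _)

  comp-⊟ : ∀ F g → comp (⊟ F) g ≋ ⊟ comp F g
  comp-⊟ F g = coeffwise λ n → trans (∑-cong n (λ r → sym (-‿distribˡ-* _ _))) (∑-neg n _)

  comp-const : ∀ a g → comp (const a) g ≋ const a
  comp-const a g = coeffwise λ n → trans (∑-const n a _) (const-at n)
    where
    const-at : ∀ n → a * 𝟙 n ≈ const a n
    const-at zero    = *-identityʳ a
    const-at (suc n) = zeroʳ a

  comp-𝕏 : ∀ g → Ord≥ 1 g → comp 𝕏 g ≋ g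
  comp-𝕏 g g≥1 = coeffwise comp-𝕏-at
    where
    comp-𝕏-at : ∀ n → comp 𝕏 g n ≈ g n
    comp-𝕏-at zero    = trans (zeroˡ _) (sym (g≥1 (s≤s z≤n)))
    comp-𝕏-at (suc n) = trans (∑-𝕏 n _) (⊠-identityʳ g (suc n))

  comp-⊠ : ∀ F G g → Ord≥ 1 g → comp (F ⊠ G) g ≋ comp F g ⊠ comp G g
  comp-⊠ F G g g≥1 = coeffwise λ n → sym (expand n)
    where
    open RingSolver R
    rearrange : ∀ a b c d → (a * b) * (c * d) ≈ (a * c) * (b * d)
    rearrange = solve 4 (λ a b c d → (a :* b) :* (c :* d) := (a :* c) :* (b :* d)) refl
    expand : ∀ n → (comp F g ⊠ comp G g) n ≈ comp (F ⊠ G) g n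
    expand n = begin
      ∑ n (λ j → comp F g j * comp G g (n ∸ j))
        ≈⟨ ∑-cong≤ n (λ {j} j≤n → *-cong (comp-extend g≥1 j≤n) (comp-extend g≥1 (m∸n≤m n j))) ⟩
      ∑ n (λ j → ∑ n (λ r → F r * (g ^ r) j) * ∑ n (λ t → G t * (g ^ t) (n ∸ j)))
        ≈⟨ ∑-cong n (λ j → trans (*-distribʳ-∑ n _ _) (∑-cong n (λ r → trans (*-distribˡ-∑ n _ _)
                                                                 (∑-cong n (λ t → rearrange _ _ _ _))))) ⟩
      ∑ n (λ j → ∑ n (λ r → ∑ n (λ t → (F r * G t) * ((g ^ r) j * (g ^ t) (n ∸ j)))))
        ≈⟨ trans (∑-comm n n _) (∑-cong n (λ r → ∑-comm n n _)) ⟩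
      ∑ n (λ r → ∑ n (λ t → ∑ n (λ j → (F r * G t) * ((g ^ r) j * (g ^ t) (n ∸ j)))))
        ≈⟨ ∑-cong n (λ r → ∑-cong n (λ t → trans (sym (*-distribˡ-∑ n _ _)) (*-cong refl (sym (coeff (^-homo-* g r t) n))))) ⟩
      ∑ n (λ r → ∑ n (λ t → Φ r t))
        ≈⟨ ∑-cong≤ n (λ {r} r≤n → ∑-truncate (m∸n≤m n r) (λ n∸r<t _ → Φ-vanishes r≤n n∸r<t)) ⟩
      ∑ n (λ r → ∑ (n ∸ r) (λ t → Φ r t))
        ≈⟨ ∑-triangle n Φ ⟨
      ∑ n (λ p → ∑ p (λ r → Φ r (p ∸ r)))
        ≈⟨ ∑-cong n (λ p → ∑-cong≤ p (λ r≤p → *-cong refl (reflexive (≡.cong (λ k → (g ^ k) n) (m+[n∸m]≡n r≤p))))) ⟩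
      ∑ n (λ p → ∑ p (λ r → (F r * G (p ∸ r)) * (g ^ p) n))
        ≈⟨ ∑-cong n (λ p → *-distribʳ-∑ p _ _) ⟨
      comp (F ⊠ G) g n ∎
      where
      Φ : ℕ → ℕ → Carrier
      Φ r t = (F r * G t) * (g ^ (r ℕ.+ t)) n
      Φ-vanishes : ∀ {r t} → r ≤ n → n ∸ r < t → Φ r t ≈ 0#
      Φ-vanishes {r} {t} r≤n n∸r<t = trans (*-cong refl (Ord≥-^ (r ℕ.+ t) g≥1 n<r+t)) (zeroʳ _)
        where
        n<r+t : n < r ℕ.+ t
        n<r+t = ≡.subst (_< r ℕ.+ t) (m+[n∸m]≡n r≤n) (+-monoʳ-< r n∸r<t)

  AgreeBelow : ℕ → Series → Series → Set ℓ
  AgreeBelow k f g = ∀ {n} → n < k → f n ≈ g n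

  agree-⊠ : ∀ {k f f′ g g′} → AgreeBelow k f f′ → AgreeBelow k g g′ → AgreeBelow k (f ⊠ g) (f′ ⊠ g′)
  agree-⊠ f≈f′ g≈g′ {n} n<k =
    ∑-cong≤ n (λ {j} j≤n → *-cong (f≈f′ (≤-<-trans j≤n n<k)) (g≈g′ (≤-<-trans (m∸n≤m n j) n<k)))

  agree-^ : ∀ {k f g} r → AgreeBelow k f g → AgreeBelow k (f ^ r) (g ^ r)
  agree-^ zero    f≈g n<k = refl
  agree-^ (suc r) f≈g     = agree-⊠ f≈g (agree-^ r f≈g)

  agree-comp : ∀ F {n a b} → AgreeBelow (suc n) a b → comp F a n ≈ comp F b n
  agree-comp F {n} a≈b = ∑-cong n (λ r → *-cong refl (agree-^ r a≈b ≤-refl))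

  Ord≥-agree-⊠ : ∀ j {k h f g} → Ord≥ j h → AgreeBelow k f g → AgreeBelow (j ℕ.+ k) (h ⊠ f) (h ⊠ g)
  Ord≥-agree-⊠ j {k} {h} {f} {g} h≥j f≈g {n} n<j+k = ∑-cong≤ n term
    where
    term : ∀ {i} → i ≤ n → h i * f (n ∸ i) ≈ h i * g (n ∸ i)
    term {i} i≤n with i <? j
    ... | yes i<j = trans (*-cong (h≥j i<j) refl) (trans (zeroˡ _) (sym (trans (*-cong (h≥j i<j) refl) (zeroˡ _))))
    ... | no  i≮j = *-cong refl (f≈g (∸-<-shift j (≮⇒≥ i≮j) i≤n n<j+k))

  agree-^-gain : ∀ r {k a b} → Ord≥ 1 a → Ord≥ 1 b → AgreeBelow k a b →
                 AgreeBelow (r ℕ.+ k) (a ^ suc r) (b ^ suc r)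
  agree-^-gain zero    {a = a} {b} _ _ a≈b n<k =
    trans (⊠-identityʳ a _) (trans (a≈b n<k) (sym (⊠-identityʳ b _)))
  agree-^-gain (suc r) {k} {a} {b} a≥1 b≥1 a≈b {n} n<r+k = begin
    (a ⊠ a ^ suc r) n   ≈⟨ Ord≥-agree-⊠ 1 a≥1 (agree-^-gain r a≥1 b≥1 a≈b) n<r+k ⟩
    (a ⊠ b ^ suc r) n   ≈⟨ ⊠-comm a _ n ⟩
    (b ^ suc r ⊠ a) n   ≈⟨ Ord≥-agree-⊠ (suc r) (Ord≥-^ (suc r) b≥1) a≈b n<r+k ⟩
    (b ^ suc r ⊠ b) n   ≈⟨ ⊠-comm _ b n ⟩
    (b ⊠ b ^ suc r) n   ∎

  comp-agree-gain : ∀ {G k a b} → Ord≥ 2 G → Ord≥ 1 a → Ord≥ 1 b → AgreeBelow k a b →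
                    AgreeBelow (suc k) (comp G a) (comp G b)
  comp-agree-gain {G} {k} {a} {b} G≥2 a≥1 b≥1 a≈b {n} n<1+k = ∑-cong n term
    where
    G-vanishes : ∀ {r} x y → r < 2 → G r * x ≈ G r * y
    G-vanishes x y r<2 = trans (*-cong (G≥2 r<2) refl) (trans (zeroˡ x) (sym (trans (*-cong (G≥2 r<2) refl) (zeroˡ y))))
    term : ∀ r → G r * (a ^ r) n ≈ G r * (b ^ r) n
    term zero          = G-vanishes _ _ (s≤s z≤n)
    term (suc zero)    = G-vanishes _ _ (s≤s (s≤s z≤n))
    term (suc (suc r)) = *-cong refl (agree-^-gain (suc r) a≥1 b≥1 a≈b (≤-trans n<1+k (s≤s (m≤n+m k r))))

  -- gᵣ₊₁ = gᵣ + (x − F ∘ gᵣ), g₀ = 0.  For F = x + O(x²), F − x = O(x²) makes this a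
  -- contraction: each step fixes one more coefficient of the inverse (comp-agree-gain).
  inverseApprox : Series → ℕ → Series
  inverseApprox F zero    = 𝟘
  inverseApprox F (suc r) = inverseApprox F r ⊞ (𝕏 ⊞ ⊟ comp F (inverseApprox F r))

  inverse : Series → Series
  inverse F n = inverseApprox F n n

  inverse-Ord≥1 : ∀ {F} → Ord≥ 1 (inverse F)
  inverse-Ord≥1 (s≤s z≤n) = refl

  module _ {F : Series} (F0≈0 : F 0 ≈ 0#) (F1≈1 : F 1 ≈ 1#) where
    open RingSolver R

    private
      g : ℕ → Series
      g = inverseApprox F

      residual-0 : ∀ a → (𝕏 ⊞ ⊟ comp F a) 0 ≈ 0#
      residual-0 a = trans (+-cong refl (-‿cong (trans (comp-0 F a) F0≈0))) (trans (+-identityˡ _) -0#≈0#)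

      g≥1 : ∀ r → Ord≥ 1 (g r)
      g≥1 zero    (s≤s z≤n) = refl
      g≥1 (suc r) (s≤s z≤n) = trans (+-cong (g≥1 r (s≤s z≤n)) (residual-0 (g r))) (+-identityˡ 0#)

      G : Series
      G = F ⊞ ⊟ 𝕏

      G≥2 : Ord≥ 2 G
      G≥2 {zero}        _ = trans (+-cong F0≈0 refl) (trans (+-identityˡ _) -0#≈0#)
      G≥2 {suc zero}    _ = trans (+-cong F1≈1 refl) (-‿inverseʳ 1#)
      G≥2 {suc (suc n)} (s≤s (s≤s ()))

      comp-F : ∀ a n → Ord≥ 1 a → comp F a n ≈ comp G a n + a n
      comp-F a n a≥1 = begin
        comp F a n                ≈⟨ coeff (comp-cong F≈G+𝕏 (S.refl {a})) n ⟩
        comp (G ⊞ 𝕏) a n          ≈⟨ coeff (comp-⊞ G 𝕏 a) n ⟩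
        comp G a n + comp 𝕏 a n   ≈⟨ +-cong refl (coeff (comp-𝕏 a a≥1) n) ⟩
        comp G a n + a n          ∎
        where
        F≈G+𝕏 : F ≋ G ⊞ 𝕏
        F≈G+𝕏 = coeffwise λ n → solve 2 (λ f x → f := (f :- x) :+ x) refl (F n) (𝕏 n)

      comp-g≈𝕏 : ∀ r → AgreeBelow (suc r) (comp F (g r)) 𝕏
      g-step : ∀ r → AgreeBelow (suc r) (g (suc r)) (g r)

      comp-g≈𝕏 zero    (s≤s z≤n) = trans (comp-0 F 𝟘) F0≈0
      comp-g≈𝕏 (suc r) {n} n<2+r = begin
        comp F (g (suc r)) n                     ≈⟨ comp-F (g (suc r)) n (g≥1 (suc r)) ⟩
        comp G (g (suc r)) n + g (suc r) n
          ≈⟨ +-cong (comp-agree-gain G≥2 (g≥1 (suc r)) (g≥1 r) (g-step r) n<2+r) refl ⟩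
        comp G (g r) n + (g r n + (𝕏 n - comp F (g r) n))
          ≈⟨ +-cong refl (+-cong refl (+-cong refl (-‿cong (comp-F (g r) n (g≥1 r))))) ⟩
        comp G (g r) n + (g r n + (𝕏 n - (comp G (g r) n + g r n)))
          ≈⟨ solve 3 (λ c a x → c :+ (a :+ (x :- (c :+ a))) := x) refl _ _ _ ⟩
        𝕏 n                                      ∎

      g-step r n<1+r =
        trans (+-cong refl (trans (+-cong refl (-‿cong (comp-g≈𝕏 r n<1+r))) (-‿inverseʳ _))) (+-identityʳ _)

      g-stable : ∀ {n} N → n ≤ N → g N n ≈ g n n
      g-stable zero    z≤n   = refl
      g-stable (suc N) n≤1+N with m≤n⇒m<n∨m≡n n≤1+N
      ... | inj₂ ≡.refl     = refl
      ... | inj₁ (s≤s n≤N) = trans (g-step N (s≤s n≤N)) (g-stable N n≤N)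

    comp-inverse : comp F (inverse F) ≋ 𝕏
    comp-inverse = coeffwise λ n →
      trans (agree-comp F (λ j<1+n → sym (g-stable n (≤-pred j<1+n)))) (comp-g≈𝕏 n ≤-refl)

module Derivative {c ℓ} (R : CommutativeRing c ℓ) where
  open CommutativeRing R
  open FiniteSums R
  open PowerSeries R
  open Composition R
  open import Algebra.Properties.Ring ring using (-0#≈0#; -‿+-comm)
  open import Algebra.Properties.Semiring.Mult semiring using (_×_; ×-congʳ; ×-homo-+; ×-idem; ×-assoc-*; ×-comm-*)
  open import Algebra.Properties.CommutativeMonoid.Mult +-commutativeMonoid using (×-distrib-+)
  open import Data.Nat.Properties using (m+[n∸m]≡n; +-∸-assoc; n∸n≡0)
  import Relation.Binary.Reasoning.Setoid as SetoidReasoning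
  private module ≈-Reasoning = SetoidReasoning setoid

  private module S = CommutativeRing powerSeriesRing

  ∂ : Series → Series
  ∂ f n = suc n × f (suc n)

  ×-zeroʳ : ∀ k → k × 0# ≈ 0#
  ×-zeroʳ zero    = refl
  ×-zeroʳ (suc k) = ×-idem (+-identityʳ 0#) (suc k)

  ×-neg : ∀ k x → k × (- x) ≈ - (k × x)
  ×-neg zero    x = sym -0#≈0#
  ×-neg (suc k) x = trans (+-cong refl (×-neg k x)) (-‿+-comm _ _)

  ∂-cong : ∀ {f g} → f ≋ g → ∂ f ≋ ∂ g
  ∂-cong f≋g = coeffwise λ n → ×-congʳ (suc n) (coeff f≋g (suc n))

  ∂-⊞ : ∀ f g → ∂ (f ⊞ g) ≋ ∂ f ⊞ ∂ g
  ∂-⊞ f g = coeffwise λ n → ×-distrib-+ _ _ (suc n)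

  ∂-⊟ : ∀ f → ∂ (⊟ f) ≋ ⊟ ∂ f
  ∂-⊟ f = coeffwise λ n → ×-neg (suc n) _

  ∂-const : ∀ a → ∂ (const a) ≋ 𝟘
  ∂-const a = coeffwise λ n → ×-zeroʳ (suc n)

  ∂-𝕏 : ∂ 𝕏 ≋ 𝟙
  ∂-𝕏 = coeffwise λ { zero → +-identityʳ 1# ; (suc n) → ×-zeroʳ (suc (suc n)) }

  ∂-⊠ : ∀ f g → ∂ (f ⊠ g) ≋ ∂ f ⊠ g ⊞ f ⊠ ∂ g
  ∂-⊠ f g = coeffwise leibniz
    where
    leibniz : ∀ n → ∂ (f ⊠ g) n ≈ (∂ f ⊠ g) n + (f ⊠ ∂ g) n
    leibniz n = begin
      suc n × ∑ (suc n) T                                        ≈⟨ ×-distrib-∑ (suc n) (suc n) T ⟩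
      ∑ (suc n) (λ j → suc n × T j)                              ≈⟨ ∑-cong≤ (suc n) split ⟩
      ∑ (suc n) (λ j → j × T j + (suc n ∸ j) × T j)              ≈⟨ ∑-distrib-+ (suc n) _ _ ⟩
      ∑ (suc n) (λ j → j × T j) + ∑ (suc n) (λ j → (suc n ∸ j) × T j)
                                                                 ≈⟨ +-cong left right ⟩
      (∂ f ⊠ g) n + (f ⊠ ∂ g) n                                  ∎
      where
      open ≈-Reasoning
      T : ℕ → Carrier
      T j = f j * g (suc n ∸ j)
      split : ∀ {j} → j ≤ suc n → suc n × T j ≈ j × T j + (suc n ∸ j) × T j
      split {j} j≤ = trans (reflexive (≡.cong (_× T j) (≡.sym (m+[n∸m]≡n j≤)))) (×-homo-+ (T j) j (suc n ∸ j))
      left : ∑ (suc n) (λ j → j × T j) ≈ (∂ f ⊠ g) n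
      left = begin
        ∑ (suc n) (λ j → j × T j)                    ≈⟨ ∑-suc n _ ⟩
        0# + ∑ n (λ j → suc j × T (suc j))           ≈⟨ +-identityˡ _ ⟩
        ∑ n (λ j → suc j × T (suc j))                ≈⟨ ∑-cong n (λ j → sym (×-assoc-* (suc j) _ _)) ⟩
        (∂ f ⊠ g) n                                  ∎
      right : ∑ (suc n) (λ j → (suc n ∸ j) × T j) ≈ (f ⊠ ∂ g) n
      right = begin
        ∑ n (λ j → (suc n ∸ j) × T j) + (suc n ∸ suc n) × T (suc n)
          ≈⟨ +-cong (∑-cong≤ n inner) (reflexive (≡.cong (_× T (suc n)) (n∸n≡0 n))) ⟩
        (f ⊠ ∂ g) n + 0#                             ≈⟨ +-identityʳ _ ⟩
        (f ⊠ ∂ g) n                                  ∎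
        where
        inner : ∀ {j} → j ≤ n → (suc n ∸ j) × T j ≈ f j * ∂ g (n ∸ j)
        inner {j} j≤n rewrite +-∸-assoc 1 j≤n = sym (×-comm-* (suc (n ∸ j)) (f j) _)

  open import Algebra.Properties.Semiring.Mult S.semiring using ()
    renaming (×-congʳ to ×ₛ-congʳ; ×-comm-* to ×ₛ-comm-⊠)

  ∂-^ : ∀ r g → ∂ (g ^ suc r) ≋ suc r ×ₛ (g ^ r ⊠ ∂ g)
  ∂-^ zero    g = begin
    ∂ (g ⊠ 𝟙)          ≈⟨ ∂-cong (S.*-identityʳ g) ⟩
    ∂ g                ≈⟨ S.*-identityˡ (∂ g) ⟨
    𝟙 ⊠ ∂ g            ≈⟨ S.+-identityʳ (𝟙 ⊠ ∂ g) ⟨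
    1 ×ₛ (𝟙 ⊠ ∂ g)     ∎
    where open ≋-Reasoning
  ∂-^ (suc r) g = begin
    ∂ (g ⊠ g ^ suc r)                                ≈⟨ ∂-⊠ g (g ^ suc r) ⟩
    ∂ g ⊠ g ^ suc r ⊞ g ⊠ ∂ (g ^ suc r)              ≈⟨ ⊞-cong (S.*-comm (∂ g) (g ^ suc r)) (⊠-congˡ g (∂-^ r g)) ⟩
    g ^ suc r ⊠ ∂ g ⊞ g ⊠ (suc r ×ₛ (g ^ r ⊠ ∂ g))    ≈⟨ ⊞-congˡ (g ^ suc r ⊠ ∂ g) (×ₛ-comm-⊠ (suc r) g (g ^ r ⊠ ∂ g)) ⟩
    g ^ suc r ⊠ ∂ g ⊞ suc r ×ₛ (g ⊠ (g ^ r ⊠ ∂ g))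
      ≈⟨ ⊞-congˡ (g ^ suc r ⊠ ∂ g) (×ₛ-congʳ (suc r) (S.*-assoc g (g ^ r) (∂ g))) ⟨
    suc (suc r) ×ₛ (g ^ suc r ⊠ ∂ g)                 ∎
    where open ≋-Reasoning

  chain : ∀ F g → Ord≥ 1 g → ∂ (comp F g) ≋ comp (∂ F) g ⊠ ∂ g
  chain F g g≥1 = coeffwise chain-at
    where
    chain-at : ∀ n → ∂ (comp F g) n ≈ (comp (∂ F) g ⊠ ∂ g) n
    chain-at n = begin
      suc n × ∑ (suc n) (λ r → F r * (g ^ r) (suc n))
        ≈⟨ ×-distrib-∑ (suc n) (suc n) _ ⟩
      ∑ (suc n) (λ r → suc n × (F r * (g ^ r) (suc n)))
        ≈⟨ ∑-cong (suc n) (λ r → sym (×-comm-* (suc n) (F r) _)) ⟩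
      ∑ (suc n) (λ r → F r * ∂ (g ^ r) n)
        ≈⟨ ∑-suc n _ ⟩
      F 0 * ∂ 𝟙 n + ∑ n (λ r → F (suc r) * ∂ (g ^ suc r) n)
        ≈⟨ +-cong (trans (*-cong refl (coeff (∂-const 1#) n)) (zeroʳ _)) (∑-cong n (λ r → *-cong refl (coeff (∂-^ r g) n))) ⟩
      0# + ∑ n (λ r → F (suc r) * (suc r ×ₛ (g ^ r ⊠ ∂ g)) n)
        ≈⟨ +-identityˡ _ ⟩
      ∑ n (λ r → F (suc r) * (suc r ×ₛ (g ^ r ⊠ ∂ g)) n)
        ≈⟨ ∑-cong n (λ r → trans (*-cong refl (×ₛ-coeff (suc r) _ n)) (trans (×-comm-* (suc r) _ _) (sym (×-assoc-* (suc r) _ _)))) ⟩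
      ∑ n (λ r → ∂ F r * ∑ n (λ j → (g ^ r) j * ∂ g (n ∸ j)))
        ≈⟨ ∑-cong n (λ r → *-distribˡ-∑ n _ _) ⟩
      ∑ n (λ r → ∑ n (λ j → ∂ F r * ((g ^ r) j * ∂ g (n ∸ j))))
        ≈⟨ ∑-comm n n _ ⟩
      ∑ n (λ j → ∑ n (λ r → ∂ F r * ((g ^ r) j * ∂ g (n ∸ j))))
        ≈⟨ ∑-cong n (λ j → trans (∑-cong n (λ r → sym (*-assoc _ _ _))) (sym (*-distribʳ-∑ n _ _))) ⟩
      ∑ n (λ j → ∑ n (λ r → ∂ F r * (g ^ r) j) * ∂ g (n ∸ j))
        ≈⟨ ∑-cong≤ n (λ j≤n → *-cong (sym (comp-extend g≥1 j≤n)) refl) ⟩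
      (comp (∂ F) g ⊠ ∂ g) n ∎
      where open ≈-Reasoning

  TorsionFree : Set (c ⊔ ℓ)
  TorsionFree = ∀ n {a} → suc n × a ≈ 0# → a ≈ 0#

  ∂≋𝟘⇒const : TorsionFree → ∀ {f} → ∂ f ≋ 𝟘 → f ≋ const (f 0)
  ∂≋𝟘⇒const torsionFree {f} ∂f≋𝟘 = coeffwise λ
    { zero    → refl
    ; (suc n) → torsionFree n (coeff ∂f≋𝟘 n) }

  unit-⊠-cancelˡ : ∀ {K X Y} → K 0 ≈ 1# → K ⊠ X ≋ K ⊠ Y → X ≋ Y
  unit-⊠-cancelˡ {K} {X} {Y} K0≈1 KX≋KY = coeffwise (<-rec _ agree)
    where
    open import Algebra.Properties.Group +-group using (∙-cancelˡ)
    open import Data.Nat.Induction using (<-rec)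
    XK≈YK : ∀ n → (X ⊠ K) n ≈ (Y ⊠ K) n
    XK≈YK n = trans (⊠-comm X K n) (trans (coeff KX≋KY n) (⊠-comm K Y n))
    K[n∸n]≈1 : ∀ n → K (n ∸ n) ≈ 1#
    K[n∸n]≈1 n = trans (reflexive (≡.cong K (n∸n≡0 n))) K0≈1
    unscale : ∀ {x y} n → x * K (n ∸ n) ≈ y * K (n ∸ n) → x ≈ y
    unscale {x} {y} n eq = begin
      x                ≈⟨ *-identityʳ x ⟨
      x * 1#           ≈⟨ *-cong refl (K[n∸n]≈1 n) ⟨
      x * K (n ∸ n)    ≈⟨ eq ⟩
      y * K (n ∸ n)    ≈⟨ *-cong refl (K[n∸n]≈1 n) ⟩
      y * 1#           ≈⟨ *-identityʳ y ⟩
      y                ∎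
      where open ≈-Reasoning
    agree : ∀ j → (∀ {i} → i < j → X i ≈ Y i) → X j ≈ Y j
    agree zero    _  = unscale 0 (XK≈YK 0)
    agree (suc m) ih = unscale m (∙-cancelˡ _ _ _ (trans (+-cong lower-terms refl) (XK≈YK (suc m))))
      where
      lower-terms : ∑ m (λ i → Y i * K (suc m ∸ i)) ≈ ∑ m (λ i → X i * K (suc m ∸ i))
      lower-terms = ∑-cong≤ m (λ i≤m → *-cong (sym (ih (s≤s i≤m))) refl)

module PowerOde {c ℓ} (R : CommutativeRing c ℓ) where
  open CommutativeRing R
  open FiniteSums R
  open PowerSeries R
  open Composition R
  open Derivative R
  open import Algebra.Properties.Ring ring using (-‿+-comm)
  open import Function using (_$_)
  open import Algebra.Properties.Semiring.Mult semiring using (_×_)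
  open ≋-Reasoning

  private module S = CommutativeRing powerSeriesRing

  -- Ode α K Y is the equation K Y′ = α Y K′, solved by Y = K^α.
  record Ode (α : Carrier) (K Y : Series) : Set ℓ where
    constructor solves
    field equation : K ⊠ ∂ Y ≋ const α ⊠ Y ⊠ ∂ K
  open Ode

  Ode-congᴷ : ∀ {α K K′ Y} → K ≋ K′ → Ode α K Y → Ode α K′ Y
  Ode-congᴷ {α} {K} {K′} {Y} K≋K′ ode = solves $ begin
    K′ ⊠ ∂ Y             ≈⟨ ⊠-congʳ (∂ Y) (S.sym K≋K′) ⟩
    K ⊠ ∂ Y              ≈⟨ equation ode ⟩
    const α ⊠ Y ⊠ ∂ K    ≈⟨ ⊠-congˡ (const α ⊠ Y) (∂-cong K≋K′) ⟩
    const α ⊠ Y ⊠ ∂ K′   ∎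

  Ode-congᵅ : ∀ {α β K Y} → α ≈ β → Ode α K Y → Ode β K Y
  Ode-congᵅ {K = K} {Y} α≈β ode = solves (S.trans (equation ode) (⊠-congʳ (∂ K) (⊠-congʳ Y (const-cong α≈β))))

  Ode-⊠ : ∀ {α β K Y Z} → Ode α K Y → Ode β K Z → Ode (α + β) K (Y ⊠ Z)
  Ode-⊠ {α} {β} {K} {Y} {Z} odeY odeZ = solves $ begin
    K ⊠ ∂ (Y ⊠ Z)                                        ≈⟨ ⊠-congˡ K (∂-⊠ Y Z) ⟩
    K ⊠ (∂ Y ⊠ Z ⊞ Y ⊠ ∂ Z)
      ≈⟨ solve 5 (λ K dY Z Y dZ → K :* (dY :* Z :+ Y :* dZ) := (K :* dY) :* Z :+ Y :* (K :* dZ)) S.refl K (∂ Y) Z Y (∂ Z) ⟩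
    (K ⊠ ∂ Y) ⊠ Z ⊞ Y ⊠ (K ⊠ ∂ Z)                        ≈⟨ ⊞-cong (⊠-congʳ Z (equation odeY)) (⊠-congˡ Y (equation odeZ)) ⟩
    (const α ⊠ Y ⊠ ∂ K) ⊠ Z ⊞ Y ⊠ (const β ⊠ Z ⊠ ∂ K)
      ≈⟨ solve 5 (λ a b Y Z dK → (a :* Y :* dK) :* Z :+ Y :* (b :* Z :* dK)
                   := (a :+ b) :* (Y :* Z) :* dK) S.refl (const α) (const β) Y Z (∂ K) ⟩
    (const α ⊞ const β) ⊠ (Y ⊠ Z) ⊠ ∂ K                  ≈⟨ ⊠-congʳ (∂ K) (⊠-congʳ (Y ⊠ Z) (const-+ α β)) ⟨
    const (α + β) ⊠ (Y ⊠ Z) ⊠ ∂ K                        ∎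
    where open RingSolver powerSeriesRing

  Ode-self : ∀ K → Ode 1# K K
  Ode-self K = solves (S.sym (⊠-congʳ (∂ K) (S.*-identityˡ K)))

  Ode-comp : ∀ {α K B} s → Ord≥ 1 s → Ode α K B → Ode α (comp K s) (comp B s)
  Ode-comp {α} {K} {B} s s≥1 ode = solves $ begin
    comp K s ⊠ ∂ (comp B s)                   ≈⟨ ⊠-congˡ (comp K s) (chain B s s≥1) ⟩
    comp K s ⊠ (comp (∂ B) s ⊠ ∂ s)           ≈⟨ S.*-assoc (comp K s) (comp (∂ B) s) (∂ s) ⟨
    comp K s ⊠ comp (∂ B) s ⊠ ∂ s             ≈⟨ ⊠-congʳ (∂ s) (comp-⊠ K (∂ B) s s≥1) ⟨
    comp (K ⊠ ∂ B) s ⊠ ∂ s                    ≈⟨ ⊠-congʳ (∂ s) (comp-cong (equation ode) (S.refl {s})) ⟩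
    comp (const α ⊠ B ⊠ ∂ K) s ⊠ ∂ s          ≈⟨ ⊠-congʳ (∂ s) (comp-⊠ (const α ⊠ B) (∂ K) s s≥1) ⟩
    comp (const α ⊠ B) s ⊠ comp (∂ K) s ⊠ ∂ s ≈⟨ ⊠-congʳ (∂ s) (⊠-congʳ (comp (∂ K) s) (comp-⊠ (const α) B s s≥1)) ⟩
    comp (const α) s ⊠ comp B s ⊠ comp (∂ K) s ⊠ ∂ s
                                              ≈⟨ ⊠-congʳ (∂ s) (⊠-congʳ (comp (∂ K) s) (⊠-congʳ (comp B s) (comp-const α s))) ⟩
    const α ⊠ comp B s ⊠ comp (∂ K) s ⊠ ∂ s   ≈⟨ S.*-assoc (const α ⊠ comp B s) (comp (∂ K) s) (∂ s) ⟩
    const α ⊠ comp B s ⊠ (comp (∂ K) s ⊠ ∂ s) ≈⟨ ⊠-congˡ (const α ⊠ comp B s) (chain K s s≥1) ⟨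
    const α ⊠ comp B s ⊠ ∂ (comp K s)         ∎

  Ode-binomial : ∀ {α B} h → Ord≥ 1 h → Ode α (𝟙 ⊞ 𝕏) B → Ode α (𝟙 ⊞ h) (comp B h)
  Ode-binomial {B = B} h h≥1 ode = Ode-congᴷ {Y = comp B h} comp-1+𝕏 (Ode-comp h h≥1 ode)
    where
    comp-1+𝕏 : comp (𝟙 ⊞ 𝕏) h ≋ 𝟙 ⊞ h
    comp-1+𝕏 = S.trans (comp-⊞ 𝟙 𝕏 h) (⊞-cong (comp-const 1# h) (comp-𝕏 h h≥1))

  binomial-Ode : ∀ {α B} → (∀ n → suc n × B (suc n) + n × B n ≈ α * B n) → Ode α (𝟙 ⊞ 𝕏) B
  binomial-Ode {α} {B} recurrence = solves $ begin
    (𝟙 ⊞ 𝕏) ⊠ ∂ B              ≈⟨ coeffwise coefficient ⟩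
    const α ⊠ B                ≈⟨ S.*-identityʳ (const α ⊠ B) ⟨
    const α ⊠ B ⊠ 𝟙            ≈⟨ ⊠-congˡ (const α ⊠ B) ∂[1+𝕏]≋𝟙 ⟨
    const α ⊠ B ⊠ ∂ (𝟙 ⊞ 𝕏)    ∎
    where
    ∂[1+𝕏]≋𝟙 : ∂ (𝟙 ⊞ 𝕏) ≋ 𝟙
    ∂[1+𝕏]≋𝟙 = S.trans (∂-⊞ 𝟙 𝕏) (S.trans (⊞-cong (∂-const 1#) ∂-𝕏) (S.+-identityˡ 𝟙))
    shifted : ∀ n → ∂ B n + (𝕏 ⊠ ∂ B) n ≈ α * B n
    shifted zero    = trans (+-cong refl (𝕏-⊠-zero (∂ B))) (recurrence 0)
    shifted (suc n) = trans (+-cong refl (𝕏-⊠-suc (∂ B) n)) (recurrence (suc n))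
    coefficient : ∀ n → ((𝟙 ⊞ 𝕏) ⊠ ∂ B) n ≈ (const α ⊠ B) n
    coefficient n = trans (coeff (S.distribʳ (∂ B) 𝟙 𝕏) n)
                          (trans (+-cong (coeff (S.*-identityˡ (∂ B)) n) refl)
                                 (trans (shifted n) (sym (const-⊠ α B n))))

  const0-⊠ : ∀ f → const 0# ⊠ f ≋ 𝟘
  const0-⊠ f = coeffwise λ n → trans (const-⊠ 0# f n) (zeroˡ _)

  Ode-0⇒const : TorsionFree → ∀ {K Y} → K 0 ≈ 1# → Ode 0# K Y → Y ≋ const (Y 0)
  Ode-0⇒const torsionFree {K} {Y} K0≈1 ode = ∂≋𝟘⇒const torsionFree (unit-⊠-cancelˡ K0≈1 (begin
    K ⊠ ∂ Y                ≈⟨ equation ode ⟩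
    const 0# ⊠ Y ⊠ ∂ K     ≈⟨ ⊠-congʳ (∂ K) (const0-⊠ Y) ⟩
    𝟘 ⊠ ∂ K                ≈⟨ S.zeroˡ (∂ K) ⟩
    𝟘                      ≈⟨ S.zeroʳ K ⟨
    K ⊠ 𝟘                  ∎))

  Ode-⊠≋𝟙 : TorsionFree → ∀ {α β K Y Z} → K 0 ≈ 1# → Ode α K Y → Ode β K Z →
            α + β ≈ 0# → Y 0 * Z 0 ≈ 1# → Y ⊠ Z ≋ 𝟙
  Ode-⊠≋𝟙 torsionFree K0≈1 odeY odeZ α+β≈0 Y0Z0≈1 =
    S.trans (Ode-0⇒const torsionFree K0≈1 (Ode-congᵅ α+β≈0 (Ode-⊠ odeY odeZ))) (const-cong Y0Z0≈1)

  module _ (torsionFree : TorsionFree) {h : Carrier} (h+h≈1 : h + h ≈ 1#) where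

    Ode-half-inverse : ∀ {K c U} → K 0 ≈ 1# → c 0 ≈ 1# → U 0 ≈ 1# →
                       Ode h K c → Ode (- h) K U → c ⊠ U ≋ 𝟙
    Ode-half-inverse K0≈1 c0≈1 U0≈1 odec odeU =
      Ode-⊠≋𝟙 torsionFree K0≈1 odec odeU (-‿inverseʳ h) (trans (*-cong c0≈1 U0≈1) (*-identityˡ 1#))

    Ode-half-square : ∀ {K c U} → K 0 ≈ 1# → c 0 ≈ 1# → U 0 ≈ 1# →
                      Ode h K c → Ode (- h) K U → c ⊠ c ≋ K
    Ode-half-square {K} {c} {U} K0≈1 c0≈1 U0≈1 odec odeU = begin
      c ⊠ c                        ≈⟨ S.*-identityʳ (c ⊠ c) ⟨
      c ⊠ c ⊠ 𝟙                    ≈⟨ ⊠-congˡ (c ⊠ c) UUK≋𝟙 ⟨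
      c ⊠ c ⊠ (U ⊠ U ⊠ K)          ≈⟨ solve 3 (λ c u k → c :* c :* (u :* u :* k) := (c :* u) :* (c :* u) :* k) S.refl c U K ⟩
      (c ⊠ U) ⊠ (c ⊠ U) ⊠ K        ≈⟨ ⊠-congʳ K (⊠-cong cU≋𝟙 cU≋𝟙) ⟩
      𝟙 ⊠ 𝟙 ⊠ K                    ≈⟨ solve 1 (λ k → con (ℤ.+ 1) :* con (ℤ.+ 1) :* k := k) S.refl K ⟩
      K                            ∎
      where
      open RingSolver powerSeriesRing
      import Data.Integer as ℤ
      cU≋𝟙 : c ⊠ U ≋ 𝟙
      cU≋𝟙 = Ode-half-inverse K0≈1 c0≈1 U0≈1 odec odeU
      exponent : (- h + - h) + 1# ≈ 0#
      exponent = trans (+-cong (-‿+-comm h h) (sym h+h≈1)) (-‿inverseˡ (h + h))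
      UUK≋𝟙 : U ⊠ U ⊠ K ≋ 𝟙
      UUK≋𝟙 = Ode-⊠≋𝟙 torsionFree K0≈1 (Ode-⊠ odeU odeU) (Ode-self K) exponent
                (trans (*-cong (trans (*-cong U0≈1 U0≈1) (*-identityˡ 1#)) K0≈1) (*-identityˡ 1#))

module NatParity where
  open import Data.Nat.Properties using (m+[n∸m]≡n; +-suc)
  open import Data.Parity.Properties using (+-homo-+)

  parity-suc : ∀ n → parity (suc n) ≡.≡ parity n ⁻¹
  parity-suc zero          = ≡.refl
  parity-suc (suc zero)    = ≡.refl
  parity-suc (suc (suc n)) = parity-suc n

  parity-∸ : ∀ {j n} → j ≤ n → parity (n ∸ j) ≡.≡ parity n ℙ.+ parity j
  parity-∸ {j} {n} j≤n = cancel (parity j) (parity (n ∸ j)) (≡.trans (≡.cong parity (≡.sym (m+[n∸m]≡n j≤n))) (+-homo-+ j (n ∸ j)))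
    where
    cancel : ∀ a y {x} → x ≡.≡ a ℙ.+ y → y ≡.≡ x ℙ.+ a
    cancel 0ℙ 0ℙ ≡.refl = ≡.refl
    cancel 0ℙ 1ℙ ≡.refl = ≡.refl
    cancel 1ℙ 0ℙ ≡.refl = ≡.refl
    cancel 1ℙ 1ℙ ≡.refl = ≡.refl

  ⌊even+n/2⌋ : ∀ j n → parity j ≡.≡ 0ℙ → ⌊ j ℕ.+ n /2⌋ ≡.≡ ⌊ j /2⌋ ℕ.+ ⌊ n /2⌋
  ⌊even+n/2⌋ zero          n _    = ≡.refl
  ⌊even+n/2⌋ (suc (suc j)) n even = ≡.cong suc (⌊even+n/2⌋ j n even)

  ⌊1+even/2⌋ : ∀ n → parity n ≡.≡ 0ℙ → ⌊ suc n /2⌋ ≡.≡ ⌊ n /2⌋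
  ⌊1+even/2⌋ zero          _    = ≡.refl
  ⌊1+even/2⌋ (suc (suc n)) even = ≡.cong suc (⌊1+even/2⌋ n even)

  ⌊1+odd/2⌋ : ∀ n → parity n ≡.≡ 1ℙ → ⌊ suc n /2⌋ ≡.≡ suc ⌊ n /2⌋
  ⌊1+odd/2⌋ (suc zero)    _   = ≡.refl
  ⌊1+odd/2⌋ (suc (suc n)) odd = ≡.cong suc (⌊1+odd/2⌋ n odd)

  [p+q]⁻¹+p≡q⁻¹ : ∀ p q → (p ℙ.+ q) ⁻¹ ℙ.+ p ≡.≡ q ⁻¹
  [p+q]⁻¹+p≡q⁻¹ 0ℙ 0ℙ = ≡.refl
  [p+q]⁻¹+p≡q⁻¹ 0ℙ 1ℙ = ≡.refl
  [p+q]⁻¹+p≡q⁻¹ 1ℙ 0ℙ = ≡.refl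
  [p+q]⁻¹+p≡q⁻¹ 1ℙ 1ℙ = ≡.refl

  ≢⇒≡⁻¹ : ∀ {x p} → x ≢ p → x ≡.≡ p ⁻¹
  ≢⇒≡⁻¹ {0ℙ} {1ℙ} _  = ≡.refl
  ≢⇒≡⁻¹ {1ℙ} {0ℙ} _  = ≡.refl
  ≢⇒≡⁻¹ {0ℙ} {0ℙ} x≢ = ⊥-elim (x≢ ≡.refl)
  ≢⇒≡⁻¹ {1ℙ} {1ℙ} x≢ = ⊥-elim (x≢ ≡.refl)

  parity-+-cancel : ∀ {b d} → parity b ≡.≡ parity (b ℕ.+ d) → parity d ≡.≡ 0ℙ
  parity-+-cancel {b} {d} b≡b+d = cancel (parity b) (parity d) (≡.trans b≡b+d (+-homo-+ b d))
    where
    cancel : ∀ x y → x ≡.≡ x ℙ.+ y → y ≡.≡ 0ℙ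
    cancel 0ℙ 0ℙ _ = ≡.refl
    cancel 1ℙ 0ℙ _ = ≡.refl

  2*suc : ∀ n → 2 ℕ.* suc n ≡.≡ suc (suc (2 ℕ.* n))
  2*suc n = ≡.cong suc (+-suc n (n ℕ.+ 0))

  ⌊2*n/2⌋≡n : ∀ n → ⌊ 2 ℕ.* n /2⌋ ≡.≡ n
  ⌊2*n/2⌋≡n zero    = ≡.refl
  ⌊2*n/2⌋≡n (suc n) = ≡.trans (≡.cong ⌊_/2⌋ (2*suc n)) (≡.cong suc (⌊2*n/2⌋≡n n))

  even⇒≡2*⌊n/2⌋ : ∀ {n} → parity n ≡.≡ 0ℙ → 2 ℕ.* ⌊ n /2⌋ ≡.≡ n
  even⇒≡2*⌊n/2⌋ {zero}        _    = ≡.refl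
  even⇒≡2*⌊n/2⌋ {suc (suc n)} even = ≡.trans (2*suc ⌊ n /2⌋) (≡.cong (suc ∘ suc) (even⇒≡2*⌊n/2⌋ even))

  odd⇒≡1+2*⌊n/2⌋ : ∀ {n} → parity n ≡.≡ 1ℙ → suc (2 ℕ.* ⌊ n /2⌋) ≡.≡ n
  odd⇒≡1+2*⌊n/2⌋ {suc zero}    _   = ≡.refl
  odd⇒≡1+2*⌊n/2⌋ {suc (suc n)} odd = ≡.trans (≡.cong suc (2*suc ⌊ n /2⌋)) (≡.cong (suc ∘ suc) (odd⇒≡1+2*⌊n/2⌋ odd))

open NatParity public

module SeriesParity {c ℓ} (R : CommutativeRing c ℓ) where
  open CommutativeRing R
  open FiniteSums R
  open PowerSeries R
  open Composition R
  open Derivative R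
  open import Algebra.Properties.Ring ring using (-0#≈0#)
  open import Data.Parity.Properties using (_≟_; ⁻¹-injective)
  open import Relation.Nullary using (yes; no)

  HasParity : Parity → Series → Set ℓ
  HasParity p f = ∀ n → parity n ≡.≡ p ⁻¹ → f n ≈ 0#

  HasParity-cong : ∀ {p f g} → f ≋ g → HasParity p f → HasParity p g
  HasParity-cong f≋g f-p n other = trans (sym (coeff f≋g n)) (f-p n other)

  HasParity-⊞ : ∀ {p f g} → HasParity p f → HasParity p g → HasParity p (f ⊞ g)
  HasParity-⊞ f-p g-p n other = trans (+-cong (f-p n other) (g-p n other)) (+-identityˡ 0#)

  HasParity-⊟ : ∀ {p f} → HasParity p f → HasParity p (⊟ f)
  HasParity-⊟ f-p n other = trans (-‿cong (f-p n other)) -0#≈0#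

  HasParity-𝟘 : ∀ p → HasParity p 𝟘
  HasParity-𝟘 p _ _ = refl

  HasParity-const : ∀ a → HasParity 0ℙ (const a)
  HasParity-const a (suc n) _ = refl

  HasParity-𝕏 : HasParity 1ℙ 𝕏
  HasParity-𝕏 zero          _ = refl
  HasParity-𝕏 (suc (suc n)) _ = refl

  HasParity-⊠ : ∀ {p p′ f g} → HasParity p f → HasParity p′ g → HasParity (p ℙ.+ p′) (f ⊠ g)
  HasParity-⊠ {p} {p′} {f} {g} f-p g-p′ n other = ∑-zero n term
    where
    term : ∀ {j} → j ≤ n → f j * g (n ∸ j) ≈ 0#
    term {j} j≤n with parity j ≟ p
    ... | yes ≡.refl  = trans (*-cong refl (g-p′ (n ∸ j) n∸j-other)) (zeroʳ _)
      where
      n∸j-other : parity (n ∸ j) ≡.≡ p′ ⁻¹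
      n∸j-other = ≡.trans (parity-∸ j≤n) (≡.trans (≡.cong (ℙ._+ p) other) ([p+q]⁻¹+p≡q⁻¹ p p′))
    ... | no  j-other = trans (*-cong (f-p j (≢⇒≡⁻¹ j-other)) refl) (zeroˡ _)

  HasParity-^-even : ∀ r {g} → HasParity 0ℙ g → HasParity 0ℙ (g ^ r)
  HasParity-^-even zero    g-even = HasParity-const 1#
  HasParity-^-even (suc r) g-even = HasParity-⊠ g-even (HasParity-^-even r g-even)

  HasParity-^-odd : ∀ r {g} → HasParity 1ℙ g → HasParity (parity r) (g ^ r)
  HasParity-^-odd zero    g-odd = HasParity-const 1#
  HasParity-^-odd (suc r) {g} g-odd =
    ≡.subst (λ p → HasParity p (g ^ suc r)) (≡.sym (parity-suc r)) (HasParity-⊠ g-odd (HasParity-^-odd r g-odd))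

  HasParity-comp-even : ∀ F {g} → HasParity 0ℙ g → HasParity 0ℙ (comp F g)
  HasParity-comp-even F g-even n other = ∑-zero n (λ {r} _ → trans (*-cong refl (HasParity-^-even r g-even n other)) (zeroʳ _))

  HasParity-comp-odd : ∀ {p F g} → HasParity p F → HasParity 1ℙ g → HasParity p (comp F g)
  HasParity-comp-odd {p} {F} {g} F-p g-odd n other = ∑-zero n term
    where
    term : ∀ {r} → r ≤ n → F r * (g ^ r) n ≈ 0#
    term {r} _ with parity r ≟ p
    ... | yes r-same  = trans (*-cong refl (HasParity-^-odd r g-odd n (≡.trans other (≡.cong _⁻¹ (≡.sym r-same))))) (zeroʳ _)
    ... | no  r-other = trans (*-cong (F-p r (≢⇒≡⁻¹ r-other)) refl) (zeroˡ _)

  HasParity-from-∂ : TorsionFree → ∀ {F} → HasParity 0ℙ (∂ F) → F 0 ≈ 0# → HasParity 1ℙ F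
  HasParity-from-∂ torsionFree ∂F-even F0≈0 zero    _    = F0≈0
  HasParity-from-∂ torsionFree ∂F-even F0≈0 (suc n) even =
    torsionFree n (∂F-even n (⁻¹-injective (≡.trans (≡.sym (parity-suc n)) even)))

  HasParity-inverse : ∀ {F} → HasParity 1ℙ F → HasParity 1ℙ (inverse F)
  HasParity-inverse {F} F-odd n other = approx-odd n n other
    where
    approx-odd : ∀ r → HasParity 1ℙ (inverseApprox F r)
    approx-odd zero    = HasParity-𝟘 1ℙ
    approx-odd (suc r) = HasParity-⊞ (approx-odd r) (HasParity-⊞ HasParity-𝕏 (HasParity-⊟ (HasParity-comp-odd F-odd (approx-odd r))))

module Twist {c ℓ} (R : CommutativeRing c ℓ) where
  open CommutativeRing R
  open FiniteSums R
  open PowerSeries R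
  open Derivative R
  open SeriesParity R
  open import Algebra.Properties.Ring ring using (-‿distribˡ-*; -‿distribʳ-*; -1*x≈-x; -0#≈0#)
  open import Data.Nat.Properties using (m+[n∸m]≡n)
  open import Algebra.Properties.Semiring.Exp semiring using (_^_; ^-homo-*)
  open import Algebra.Properties.Semiring.Mult semiring using (_×_; ×-congʳ; ×-comm-*)
  open import Data.Parity.Properties using (_≟_)
  open import Relation.Nullary using (yes; no)
  open import Relation.Binary.Reasoning.Setoid setoid

  sign : ℕ → Carrier
  sign k = (- 1#) ^ k

  -- twist f is x ↦ f(ix) for even f and x ↦ f(ix)/i for odd f, written without i.
  twist : Series → Series
  twist f n = sign ⌊ n /2⌋ * f n

  twist-cong : ∀ {f g} → f ≋ g → twist f ≋ twist g
  twist-cong f≋g = coeffwise λ n → *-cong refl (coeff f≋g n)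

  twist-⊟ : ∀ f → twist (⊟ f) ≋ ⊟ twist f
  twist-⊟ f = coeffwise λ n → sym (-‿distribʳ-* _ _)

  twist-const : ∀ a → twist (const a) ≋ const a
  twist-const a = coeffwise λ { zero → *-identityˡ a ; (suc n) → zeroʳ _ }

  twist-⊠ : ∀ {f} g → HasParity 0ℙ f → twist (f ⊠ g) ≋ twist f ⊠ twist g
  twist-⊠ {f} g f-even = coeffwise λ n → trans (*-distribˡ-∑ n _ _) (∑-cong≤ n (term n))
    where
    term : ∀ n {j} → j ≤ n → sign ⌊ n /2⌋ * (f j * g (n ∸ j)) ≈ twist f j * twist g (n ∸ j)
    term n {j} j≤n with parity j ≟ 0ℙ
    ... | no  j-odd  = trans (*-cong refl (trans (*-cong (f-even j (≢⇒≡⁻¹ j-odd)) refl) (zeroˡ _)))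
                         (trans (zeroʳ _) (sym (trans (*-cong (trans (*-cong refl (f-even j (≢⇒≡⁻¹ j-odd))) (zeroʳ _)) refl) (zeroˡ _))))
    ... | yes j-even = begin
      sign ⌊ n /2⌋ * (f j * g (n ∸ j))
        ≡⟨ ≡.cong (λ m → sign ⌊ m /2⌋ * (f j * g (n ∸ j))) (m+[n∸m]≡n j≤n) ⟨
      sign ⌊ j ℕ.+ (n ∸ j) /2⌋ * (f j * g (n ∸ j))
        ≡⟨ ≡.cong (λ m → sign m * (f j * g (n ∸ j))) (⌊even+n/2⌋ j (n ∸ j) j-even) ⟩
      sign (⌊ j /2⌋ ℕ.+ ⌊ n ∸ j /2⌋) * (f j * g (n ∸ j))           ≈⟨ *-cong (^-homo-* (- 1#) ⌊ j /2⌋ ⌊ n ∸ j /2⌋) refl ⟩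
      sign ⌊ j /2⌋ * sign ⌊ n ∸ j /2⌋ * (f j * g (n ∸ j))
        ≈⟨ solve 4 (λ a b x y → a :* b :* (x :* y) := (a :* x) :* (b :* y)) refl _ _ _ _ ⟩
      twist f j * twist g (n ∸ j)                                  ∎
      where open RingSolver R

  ∂-twist≈0 : ∀ f n → f (suc n) ≈ 0# → ∂ (twist f) n ≈ 0#
  ∂-twist≈0 f n f[1+n]≈0 = trans (×-congʳ (suc n) (trans (*-cong refl f[1+n]≈0) (zeroʳ _))) (×-zeroʳ (suc n))

  twist-∂≈0 : ∀ f n → f (suc n) ≈ 0# → twist (∂ f) n ≈ 0#
  twist-∂≈0 f n f[1+n]≈0 = trans (*-cong refl (trans (×-congʳ (suc n) f[1+n]≈0) (×-zeroʳ (suc n)))) (zeroʳ _)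

  ∂-twist-odd : ∀ {f} → HasParity 1ℙ f → ∂ (twist f) ≋ twist (∂ f)
  ∂-twist-odd {f} f-odd = coeffwise coefficient
    where
    coefficient : ∀ n → suc n × (sign ⌊ suc n /2⌋ * f (suc n)) ≈ sign ⌊ n /2⌋ * (suc n × f (suc n))
    coefficient n with parity n ≟ 0ℙ
    ... | yes n-even = trans (×-congʳ (suc n) (*-cong (reflexive (≡.cong sign (⌊1+even/2⌋ n n-even))) refl))
                             (sym (×-comm-* (suc n) _ _))
    ... | no  n-odd  = trans (∂-twist≈0 f n f[1+n]≈0) (sym (twist-∂≈0 f n f[1+n]≈0))
      where
      f[1+n]≈0 : f (suc n) ≈ 0#
      f[1+n]≈0 = f-odd (suc n) (≡.trans (parity-suc n) (≡.cong _⁻¹ (≢⇒≡⁻¹ n-odd)))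

  ∂-twist-even : ∀ {f} → HasParity 0ℙ f → ∂ (twist f) ≋ ⊟ twist (∂ f)
  ∂-twist-even {f} f-even = coeffwise coefficient
    where
    coefficient : ∀ n → suc n × (sign ⌊ suc n /2⌋ * f (suc n)) ≈ - (sign ⌊ n /2⌋ * (suc n × f (suc n)))
    coefficient n with parity n ≟ 1ℙ
    ... | yes n-odd = begin
      suc n × (sign ⌊ suc n /2⌋ * f (suc n))          ≡⟨ ≡.cong (λ k → suc n × (sign k * f (suc n))) (⌊1+odd/2⌋ n n-odd) ⟩
      suc n × ((- 1# * sign ⌊ n /2⌋) * f (suc n))      ≈⟨ ×-comm-* (suc n) _ _ ⟨
      (- 1# * sign ⌊ n /2⌋) * (suc n × f (suc n))      ≈⟨ *-cong (-1*x≈-x _) refl ⟩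
      - sign ⌊ n /2⌋ * (suc n × f (suc n))             ≈⟨ -‿distribˡ-* _ _ ⟨
      - (sign ⌊ n /2⌋ * (suc n × f (suc n)))           ∎
    ... | no  n-even = trans (∂-twist≈0 f n f[1+n]≈0) (sym (trans (-‿cong (twist-∂≈0 f n f[1+n]≈0)) -0#≈0#))
      where
      f[1+n]≈0 : f (suc n) ≈ 0#
      f[1+n]≈0 = f-even (suc n) (≡.trans (parity-suc n) (≡.cong _⁻¹ (≢⇒≡⁻¹ n-even)))

module Jacobi {c ℓ} (R : CommutativeRing c ℓ) where
  open CommutativeRing R
  open PowerSeries R
  open Composition R
  open Derivative R
  open PowerOde R
  open SeriesParity R
  open Twist R
  open import Data.Parity.Base using (0ℙ; 1ℙ)
  open import Algebra.Properties.Ring ring using (-0#≈0#)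
  open ≋-Reasoning

  private module S = CommutativeRing powerSeriesRing
  open import Algebra.Properties.Ring S.ring using () renaming (-‿involutive to ⊟-involutive)

  scaledSquare : Carrier → Series → Series
  scaledSquare k f = const k ⊠ f ⊠ f

  scaledSquare-Ord≥1 : ∀ k {f} → Ord≥ 1 f → Ord≥ 1 (scaledSquare k f)
  scaledSquare-Ord≥1 k f≥1 = Ord≥-mono (s≤s z≤n) (Ord≥-⊠ 1 1 (Ord≥-⊠ 0 1 (λ ()) f≥1) f≥1)

  scaledSquare-𝕏-suc : ∀ k n → scaledSquare k 𝕏 (suc n) ≈ k * 𝕏 n
  scaledSquare-𝕏-suc k n = trans (⊠-comm (const k ⊠ 𝕏) 𝕏 (suc n)) (trans (𝕏-⊠-suc (const k ⊠ 𝕏) n) (const-⊠ k 𝕏 n))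

  comp-scaledSquare : ∀ k {s} → Ord≥ 1 s → comp (scaledSquare k 𝕏) s ≋ scaledSquare k s
  comp-scaledSquare k {s} s≥1 = begin
    comp (const k ⊠ 𝕏 ⊠ 𝕏) s                       ≈⟨ comp-⊠ (const k ⊠ 𝕏) 𝕏 s s≥1 ⟩
    comp (const k ⊠ 𝕏) s ⊠ comp 𝕏 s                ≈⟨ ⊠-congʳ (comp 𝕏 s) (comp-⊠ (const k) 𝕏 s s≥1) ⟩
    comp (const k) s ⊠ comp 𝕏 s ⊠ comp 𝕏 s         ≈⟨ ⊠-cong (⊠-cong (comp-const k s) (comp-𝕏 s s≥1)) (comp-𝕏 s s≥1) ⟩
    const k ⊠ s ⊠ s                                ∎

  scaledSquare-even : ∀ k {f} → HasParity 1ℙ f → HasParity 0ℙ (scaledSquare k f)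
  scaledSquare-even k f-odd = HasParity-⊠ (HasParity-⊠ (HasParity-const k) f-odd) f-odd

  ∂-scaledSquare : ∀ k s → ∂ (scaledSquare k s) ≋ const k ⊠ (∂ s ⊠ s ⊞ s ⊠ ∂ s)
  ∂-scaledSquare k s = begin
    ∂ (const k ⊠ s ⊠ s)                                  ≈⟨ ∂-⊠ (const k ⊠ s) s ⟩
    ∂ (const k ⊠ s) ⊠ s ⊞ const k ⊠ s ⊠ ∂ s              ≈⟨ ⊞-congʳ (const k ⊠ s ⊠ ∂ s) (⊠-congʳ s (∂-⊠ (const k) s)) ⟩
    (∂ (const k) ⊠ s ⊞ const k ⊠ ∂ s) ⊠ s ⊞ const k ⊠ s ⊠ ∂ s
      ≈⟨ ⊞-congʳ (const k ⊠ s ⊠ ∂ s) (⊠-congʳ s (⊞-congʳ (const k ⊠ ∂ s) (⊠-congʳ s (∂-const k)))) ⟩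
    (𝟘 ⊠ s ⊞ const k ⊠ ∂ s) ⊠ s ⊞ const k ⊠ s ⊠ ∂ s
      ≈⟨ solve 3 (λ k s ds → (con (ℤ.+ 0) :* s :+ k :* ds) :* s :+ k :* s :* ds := k :* (ds :* s :+ s :* ds)) S.refl (const k) s (∂ s) ⟩
    const k ⊠ (∂ s ⊠ s ⊞ s ⊠ ∂ s)                        ∎
    where
    open RingSolver powerSeriesRing
    import Data.Integer as ℤ

  -- B⁻ and B⁺ play (1 + x)^(−1/2) and (1 + x)^(1/2), and F the elliptic integral
  -- ∫ (1 − t²)^(−1/2) (1 − k² t²)^(−1/2) dt with q = k².
  module System
    (torsionFree : TorsionFree) {h : Carrier} (h+h≈1 : h + h ≈ 1#)
    {B⁻ B⁺ : Series} (B⁻-ode : Ode (- h) (𝟙 ⊞ 𝕏) B⁻) (B⁺-ode : Ode h (𝟙 ⊞ 𝕏) B⁺)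
    (B⁻0≈1 : B⁻ 0 ≈ 1#) (B⁺0≈1 : B⁺ 0 ≈ 1#)
    (q : Carrier) {F : Series} (F0≈0 : F 0 ≈ 0#) (F1≈1 : F 1 ≈ 1#)
    (∂F : ∂ F ≋ comp B⁻ (⊟ scaledSquare 1# 𝕏) ⊠ comp B⁻ (⊟ scaledSquare q 𝕏))
    where

    sn : Series
    sn = inverse F

    sn≥1 : Ord≥ 1 sn
    sn≥1 = inverse-Ord≥1

    -- root k = (1 − k sn²)^(1/2), so cn = root 1# and dn = root q; U k = (1 − k sn²)^(−1/2).
    root U : Carrier → Series
    root k = comp B⁺ (⊟ scaledSquare k sn)
    U    k = comp (comp B⁻ (⊟ scaledSquare k 𝕏)) sn

    module _ (k : Carrier) where
      private
        K : Series
        K = 𝟙 ⊞ ⊟ scaledSquare k sn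

        K0≈1 : K 0 ≈ 1#
        K0≈1 = trans (+-cong refl (trans (-‿cong (scaledSquare-Ord≥1 k sn≥1 (s≤s z≤n))) -0#≈0#)) (+-identityʳ 1#)

        root-ode : Ode h K (root k)
        root-ode = Ode-binomial _ (Ord≥-⊟ (scaledSquare-Ord≥1 k sn≥1)) B⁺-ode

        U-ode : Ode (- h) K (U k)
        U-ode = Ode-congᴷ comp-K (Ode-comp sn sn≥1 (Ode-binomial _ (Ord≥-⊟ (scaledSquare-Ord≥1 k 𝕏-Ord≥1)) B⁻-ode))
          where
          comp-K : comp (𝟙 ⊞ ⊟ scaledSquare k 𝕏) sn ≋ K
          comp-K = S.trans (comp-⊞ 𝟙 _ sn) (⊞-cong (comp-const 1# sn) (S.trans (comp-⊟ _ sn) (⊟-cong (comp-scaledSquare k sn≥1))))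

        root0≈1 : root k 0 ≈ 1#
        root0≈1 = trans (comp-0 B⁺ (⊟ scaledSquare k sn)) B⁺0≈1

        U0≈1 : U k 0 ≈ 1#
        U0≈1 = trans (comp-0 (comp B⁻ (⊟ scaledSquare k 𝕏)) sn) (trans (comp-0 B⁻ (⊟ scaledSquare k 𝕏)) B⁻0≈1)

      root⊠U : root k ⊠ U k ≋ 𝟙
      root⊠U = Ode-half-inverse torsionFree h+h≈1 K0≈1 root0≈1 U0≈1 root-ode U-ode

      root² : root k ⊠ root k ≋ K
      root² = Ode-half-square torsionFree h+h≈1 K0≈1 root0≈1 U0≈1 root-ode U-ode

      ∂root : ∀ {d} → ∂ sn ≋ root k ⊠ d → ∂ (root k) ≋ ⊟ (const k ⊠ sn ⊠ d)
      ∂root {d} ∂sn≋cd = unit-⊠-cancelˡ K0≈1 (begin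
        K ⊠ ∂ (root k)                                             ≈⟨ Ode.equation root-ode ⟩
        const h ⊠ root k ⊠ ∂ K                                ≈⟨ ⊠-congˡ (const h ⊠ root k) ∂K ⟩
        const h ⊠ root k ⊠ ⊟ (const k ⊠ (∂ sn ⊠ sn ⊞ sn ⊠ ∂ sn))
          ≈⟨ solve 5 (λ h c k s ds → h :* c :* :- (k :* (ds :* s :+ s :* ds))
                       := :- ((h :+ h) :* k :* c :* s :* ds)) S.refl (const h) (root k) (const k) sn (∂ sn) ⟩
        ⊟ ((const h ⊞ const h) ⊠ const k ⊠ root k ⊠ sn ⊠ ∂ sn)
          ≈⟨ ⊟-cong (⊠-cong (⊠-congʳ sn (⊠-congʳ (root k) (⊠-congʳ (const k) h+h≋𝟙))) ∂sn≋cd) ⟩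
        ⊟ (𝟙 ⊠ const k ⊠ root k ⊠ sn ⊠ (root k ⊠ d))
          ≈⟨ solve 4 (λ k c s d → :- (con (ℤ.+ 1) :* k :* c :* s :* (c :* d))
                       := :- ((c :* c) :* (k :* s :* d))) S.refl (const k) (root k) sn d ⟩
        ⊟ ((root k ⊠ root k) ⊠ (const k ⊠ sn ⊠ d))                    ≈⟨ ⊟-cong (⊠-congʳ (const k ⊠ sn ⊠ d) root²) ⟩
        ⊟ (K ⊠ (const k ⊠ sn ⊠ d))
          ≈⟨ solve 2 (λ K x → :- (K :* x) := K :* :- x) S.refl K (const k ⊠ sn ⊠ d) ⟩
        K ⊠ ⊟ (const k ⊠ sn ⊠ d)                              ∎)
        where
        open RingSolver powerSeriesRing
        import Data.Integer as ℤ
        h+h≋𝟙 : const h ⊞ const h ≋ 𝟙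
        h+h≋𝟙 = S.trans (S.sym (const-+ h h)) (const-cong h+h≈1)
        ∂K : ∂ K ≋ ⊟ (const k ⊠ (∂ sn ⊠ sn ⊞ sn ⊠ ∂ sn))
        ∂K = S.trans (∂-⊞ 𝟙 (⊟ scaledSquare k sn))
               (S.trans (⊞-cong (∂-const 1#) (S.trans (∂-⊟ (scaledSquare k sn)) (⊟-cong (∂-scaledSquare k sn)))) (S.+-identityˡ _))

    ∂sn : ∂ sn ≋ root 1# ⊠ root q
    ∂sn = begin
      ∂ sn
        ≈⟨ solve 1 (λ x → x := x :* con (ℤ.+ 1) :* con (ℤ.+ 1)) S.refl (∂ sn) ⟩
      ∂ sn ⊠ 𝟙 ⊠ 𝟙                                      ≈⟨ ⊠-cong (⊠-congˡ (∂ sn) (root⊠U 1#)) (root⊠U q) ⟨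
      ∂ sn ⊠ (root 1# ⊠ U 1#) ⊠ (root q ⊠ U q)
        ≈⟨ solve 5 (λ x c u d v → x :* (c :* u) :* (d :* v) := (c :* d) :* (u :* v :* x)) S.refl (∂ sn) (root 1#) (U 1#) (root q) (U q) ⟩
      (root 1# ⊠ root q) ⊠ (U 1# ⊠ U q ⊠ ∂ sn)          ≈⟨ ⊠-congˡ (root 1# ⊠ root q) UU∂sn≋𝟙 ⟩
      (root 1# ⊠ root q) ⊠ 𝟙                            ≈⟨ S.*-identityʳ _ ⟩
      root 1# ⊠ root q                                  ∎
      where
      open RingSolver powerSeriesRing
      import Data.Integer as ℤ
      UU∂sn≋𝟙 : U 1# ⊠ U q ⊠ ∂ sn ≋ 𝟙
      UU∂sn≋𝟙 = begin
        U 1# ⊠ U q ⊠ ∂ sn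
          ≈⟨ ⊠-congʳ (∂ sn) (comp-⊠ (comp B⁻ (⊟ scaledSquare 1# 𝕏)) (comp B⁻ (⊟ scaledSquare q 𝕏)) sn sn≥1) ⟨
        comp (comp B⁻ (⊟ scaledSquare 1# 𝕏) ⊠ comp B⁻ (⊟ scaledSquare q 𝕏)) sn ⊠ ∂ sn
          ≈⟨ ⊠-congʳ (∂ sn) (comp-cong ∂F (S.refl {sn})) ⟨
        comp (∂ F) sn ⊠ ∂ sn                            ≈⟨ chain F sn sn≥1 ⟨
        ∂ (comp F sn)                                   ≈⟨ ∂-cong (comp-inverse F0≈0 F1≈1) ⟩
        ∂ 𝕏                                             ≈⟨ ∂-𝕏 ⟩
        𝟙                                               ∎

    cn dn : Series
    cn = root 1#
    dn = root q

    ∂cn : ∂ cn ≋ ⊟ (sn ⊠ dn)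
    ∂cn = S.trans (∂root 1# {dn} ∂sn) (⊟-cong (⊠-congʳ dn (S.*-identityˡ sn)))

    ∂dn : ∂ dn ≋ ⊟ (const q ⊠ sn ⊠ cn)
    ∂dn = ∂root q {cn} (S.trans ∂sn (S.*-comm cn dn))

    sn-odd : HasParity 1ℙ sn
    sn-odd = HasParity-inverse (HasParity-from-∂ torsionFree ∂F-even F0≈0)
      where
      ∂F-even : HasParity 0ℙ (∂ F)
      ∂F-even = HasParity-cong (S.sym ∂F) (HasParity-⊠ (B⁻∘-even 1#) (B⁻∘-even q))
        where
        B⁻∘-even : ∀ k → HasParity 0ℙ (comp B⁻ (⊟ scaledSquare k 𝕏))
        B⁻∘-even k = HasParity-comp-even B⁻ (HasParity-⊟ (scaledSquare-even k HasParity-𝕏))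

    root-even : ∀ k → HasParity 0ℙ (root k)
    root-even k = HasParity-comp-even B⁺ (HasParity-⊟ (scaledSquare-even k sn-odd))

    X Y Z W : Series
    X = twist dn
    Y = twist sn
    Z = twist cn
    W = Z ⊞ Y

    ∂Y : ∂ Y ≋ X ⊠ Z
    ∂Y = begin
      ∂ (twist sn)          ≈⟨ ∂-twist-odd sn-odd ⟩
      twist (∂ sn)          ≈⟨ twist-cong ∂sn ⟩
      twist (cn ⊠ dn)       ≈⟨ twist-⊠ dn (root-even 1#) ⟩
      Z ⊠ X                 ≈⟨ S.*-comm Z X ⟩
      X ⊠ Z                 ∎

    ∂Z : ∂ Z ≋ X ⊠ Y
    ∂Z = begin
      ∂ (twist cn)          ≈⟨ ∂-twist-even (root-even 1#) ⟩
      ⊟ twist (∂ cn)        ≈⟨ ⊟-cong (S.trans (twist-cong ∂cn) (twist-⊟ (sn ⊠ dn))) ⟩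
      ⊟ ⊟ twist (sn ⊠ dn)   ≈⟨ ⊟-involutive (twist (sn ⊠ dn)) ⟩
      twist (sn ⊠ dn)       ≈⟨ twist-cong (S.*-comm sn dn) ⟩
      twist (dn ⊠ sn)       ≈⟨ twist-⊠ sn (root-even q) ⟩
      X ⊠ Y                 ∎

    ∂X : ∂ X ≋ const q ⊠ Y ⊠ Z
    ∂X = begin
      ∂ (twist dn)                    ≈⟨ ∂-twist-even (root-even q) ⟩
      ⊟ twist (∂ dn)                  ≈⟨ ⊟-cong (S.trans (twist-cong ∂dn) (twist-⊟ (const q ⊠ sn ⊠ cn))) ⟩
      ⊟ ⊟ twist (const q ⊠ sn ⊠ cn)   ≈⟨ ⊟-involutive (twist (const q ⊠ sn ⊠ cn)) ⟩
      twist (const q ⊠ sn ⊠ cn)       ≈⟨ twist-cong (solve 3 (λ a s c → a :* s :* c := a :* c :* s) S.refl (const q) sn cn) ⟩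
      twist (const q ⊠ cn ⊠ sn)       ≈⟨ twist-⊠ sn (HasParity-⊠ (HasParity-const q) (root-even 1#)) ⟩
      twist (const q ⊠ cn) ⊠ Y        ≈⟨ ⊠-congʳ Y (S.trans (twist-⊠ cn (HasParity-const q)) (⊠-congʳ Z (twist-const q))) ⟩
      const q ⊠ Z ⊠ Y                 ≈⟨ solve 3 (λ a z y → a :* z :* y := a :* y :* z) S.refl (const q) Z Y ⟩
      const q ⊠ Y ⊠ Z                 ∎
      where open RingSolver powerSeriesRing

    ∂W : ∂ W ≋ X ⊠ W
    ∂W = begin
      ∂ (Z ⊞ Y)           ≈⟨ ∂-⊞ Z Y ⟩
      ∂ Z ⊞ ∂ Y           ≈⟨ ⊞-cong ∂Z ∂Y ⟩
      X ⊠ Y ⊞ X ⊠ Z       ≈⟨ S.+-comm (X ⊠ Y) (X ⊠ Z) ⟩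
      X ⊠ Z ⊞ X ⊠ Y       ≈⟨ S.distribˡ X Z Y ⟨
      X ⊠ W               ∎

    X0≈1 : X 0 ≈ 1#
    X0≈1 = trans (*-identityˡ _) (trans (comp-0 B⁺ (⊟ scaledSquare q sn)) B⁺0≈1)

    Y0≈0 : Y 0 ≈ 0#
    Y0≈0 = trans (*-identityˡ _) (sn≥1 (s≤s z≤n))

    Z0≈1 : Z 0 ≈ 1#
    Z0≈1 = trans (*-identityˡ _) (trans (comp-0 B⁺ (⊟ scaledSquare 1# sn)) B⁺0≈1)

    W0≈1 : W 0 ≈ 1#
    W0≈1 = trans (+-cong Z0≈1 Y0≈0) (+-identityʳ 1#)

data Monomial : Set where
  W^_X^_Y^_Z^_ : ℕ → ℕ → ℕ → ℕ → Monomial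

-- Polynomials in ℕ[W, X, Y, Z] as lists of monomials, repeated according to multiplicity.
derive : Monomial → List Monomial
derive (W^ a X^ b Y^ c Z^ d) =
  replicate a (W^ a X^ suc b Y^ c Z^ d) ++
  (replicate b (W^ a X^ (b ∸ 1) Y^ suc c Z^ suc d) ++
  (replicate c (W^ a X^ suc b Y^ (c ∸ 1) Z^ suc d) ++
   replicate d (W^ a X^ suc b Y^ suc c Z^ (d ∸ 1))))

Dⁿ[W] : ℕ → List Monomial
Dⁿ[W] zero    = W^ 1 X^ 0 Y^ 0 Z^ 0 ∷ []
Dⁿ[W] (suc n) = concatMap derive (Dⁿ[W] n)

module Evaluation {c ℓ} (R : CommutativeRing c ℓ) where
  open CommutativeRing R
  open PowerSeries R
  open Composition R
  open Derivative R
  import Data.Nat.Properties as ℕ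

  open import Algebra.Properties.Semiring.Mult semiring using (_×_; ×-assocˡ)
  import Relation.Binary.Reasoning.Setoid as SetoidReasoning
  private
    module S = CommutativeRing powerSeriesRing
    module ≈-Reasoning = SetoidReasoning setoid

  N : ℕ → Series
  N k = k ×ₛ 𝟙

  ∂ⁿ : ℕ → Series → Series
  ∂ⁿ zero    f = f
  ∂ⁿ (suc n) f = ∂ (∂ⁿ n f)

  open import Algebra.Properties.Semiring.Mult S.semiring using ()
    renaming (×-assoc-* to ×ₛ-assoc-⊠; ×-congʳ to ×ₛ-congʳ)

  ×ₛ≋N⊠ : ∀ k f → k ×ₛ f ≋ N k ⊠ f
  ×ₛ≋N⊠ k f = S.sym (S.trans (×ₛ-assoc-⊠ k 𝟙 f) (×ₛ-congʳ k (S.*-identityˡ f)))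

  N0-⊠ : ∀ f → N 0 ⊠ f ≋ 𝟘
  N0-⊠ f = S.zeroˡ f

  N-⊠-cong : ∀ k {f g} → (∀ {k′} → k ≡.≡ suc k′ → f ≋ g) → N k ⊠ f ≋ N k ⊠ g
  N-⊠-cong zero    {f} {g} _   = S.trans (N0-⊠ f) (S.sym (N0-⊠ g))
  N-⊠-cong (suc k) f≋g = ⊠-congˡ (N (suc k)) (f≋g ≡.refl)

  ∂-^′ : ∀ r g → ∂ (g ^ r) ≋ N r ⊠ (g ^ (r ∸ 1) ⊠ ∂ g)
  ∂-^′ zero    g = S.trans (∂-const 1#) (S.sym (N0-⊠ (g ^ 0 ⊠ ∂ g)))
  ∂-^′ (suc r) g = S.trans (∂-^ r g) (×ₛ≋N⊠ (suc r) _)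

  N-^-pred : ∀ r g → N r ⊠ (g ^ (r ∸ 1) ⊠ g) ≋ N r ⊠ g ^ r
  N-^-pred r g = N-⊠-cong r {g ^ (r ∸ 1) ⊠ g} {g ^ r} λ { {r′} ≡.refl → S.*-comm (g ^ r′) g }

  ∂ⁿ-comm : ∀ n f → ∂ (∂ⁿ n f) ≋ ∂ⁿ n (∂ f)
  ∂ⁿ-comm zero    f = S.refl
  ∂ⁿ-comm (suc n) f = ∂-cong (∂ⁿ-comm n f)

  ∂ⁿ-0 : ∀ n f → ∂ⁿ n f 0 ≈ (n ℕ.!) × f n
  ∂ⁿ-0 zero    f = sym (+-identityʳ _)
  ∂ⁿ-0 (suc n) f = begin
    ∂ (∂ⁿ n f) 0                   ≈⟨ coeff (∂ⁿ-comm n f) 0 ⟩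
    ∂ⁿ n (∂ f) 0                   ≈⟨ ∂ⁿ-0 n (∂ f) ⟩
    (n ℕ.!) × (suc n × f (suc n))  ≈⟨ ×-assocˡ (f (suc n)) (n ℕ.!) (suc n) ⟩
    (n ℕ.! ℕ.* suc n) × f (suc n)  ≡⟨ ≡.cong (_× f (suc n)) (ℕ.*-comm (n ℕ.!) (suc n)) ⟩
    (suc n ℕ.!) × f (suc n)        ∎
    where open ≈-Reasoning

  ∂-⊠⁵ : ∀ Q A B C D → ∂ Q ≋ 𝟘 →
         ∂ (Q ⊠ A ⊠ B ⊠ C ⊠ D) ≋ Q ⊠ ∂ A ⊠ B ⊠ C ⊠ D ⊞ Q ⊠ A ⊠ ∂ B ⊠ C ⊠ D
                                  ⊞ Q ⊠ A ⊠ B ⊠ ∂ C ⊠ D ⊞ Q ⊠ A ⊠ B ⊠ C ⊠ ∂ D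
  ∂-⊠⁵ Q A B C D ∂Q≋𝟘 = begin
    ∂ (Q ⊠ A ⊠ B ⊠ C ⊠ D)
      ≈⟨ S.trans (∂-⊠ (Q ⊠ A ⊠ B ⊠ C) D) (⊞-congʳ _ (⊠-congʳ D (S.trans (∂-⊠ (Q ⊠ A ⊠ B) C)
           (⊞-congʳ _ (⊠-congʳ C (S.trans (∂-⊠ (Q ⊠ A) B) (⊞-congʳ _ (⊠-congʳ B (S.trans (∂-⊠ Q A) (⊞-congʳ _ (⊠-congʳ A ∂Q≋𝟘))))))))))) ⟩
    (((𝟘 ⊠ A ⊞ Q ⊠ ∂ A) ⊠ B ⊞ Q ⊠ A ⊠ ∂ B) ⊠ C ⊞ Q ⊠ A ⊠ B ⊠ ∂ C) ⊠ D ⊞ Q ⊠ A ⊠ B ⊠ C ⊠ ∂ D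
      ≈⟨ solve 9 (λ Q A B C D dA dB dC dD → (((con (ℤ.+ 0) :* A :+ Q :* dA) :* B :+ Q :* A :* dB) :* C :+ Q :* A :* B :* dC) :* D :+ Q :* A :* B :* C :* dD
                   := Q :* dA :* B :* C :* D :+ Q :* A :* dB :* C :* D :+ Q :* A :* B :* dC :* D :+ Q :* A :* B :* C :* dD)
                 S.refl Q A B C D (∂ A) (∂ B) (∂ C) (∂ D) ⟩
    Q ⊠ ∂ A ⊠ B ⊠ C ⊠ D ⊞ Q ⊠ A ⊠ ∂ B ⊠ C ⊠ D ⊞ Q ⊠ A ⊠ B ⊠ ∂ C ⊠ D ⊞ Q ⊠ A ⊠ B ⊠ C ⊠ ∂ D ∎
    where
    open ≋-Reasoning
    open RingSolver powerSeriesRing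
    import Data.Integer as ℤ

  module Along (q : Carrier) {X Y Z W : Series}
    (∂X : ∂ X ≋ const q ⊠ Y ⊠ Z) (∂Y : ∂ Y ≋ X ⊠ Z) (∂Z : ∂ Z ≋ X ⊠ Y) (∂W : ∂ W ≋ X ⊠ W) where

    -- Evaluation at (W, X, √q Y, √q Z); no square root is needed since c + d stays even under D.
    evalMono : Monomial → Series
    evalMono (W^ a X^ b Y^ c Z^ d) = const q ^ ⌊ c ℕ.+ d /2⌋ ⊠ W ^ a ⊠ X ^ b ⊠ Y ^ c ⊠ Z ^ d

    evalList : List Monomial → Series
    evalList = List.foldr (λ m f → evalMono m ⊞ f) 𝟘

    evalList-++ : ∀ L L′ → evalList (L ++ L′) ≋ evalList L ⊞ evalList L′
    evalList-++ []      L′ = S.sym (S.+-identityˡ _)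
    evalList-++ (m ∷ L) L′ = S.trans (⊞-congˡ (evalMono m) (evalList-++ L L′)) (S.sym (S.+-assoc _ _ _))

    evalList-replicate : ∀ k m → evalList (replicate k m) ≋ N k ⊠ evalMono m
    evalList-replicate zero    m = S.sym (N0-⊠ (evalMono m))
    evalList-replicate (suc k) m = begin
      evalMono m ⊞ evalList (replicate k m)    ≈⟨ ⊞-congˡ (evalMono m) (evalList-replicate k m) ⟩
      evalMono m ⊞ N k ⊠ evalMono m            ≈⟨ ⊞-congʳ (N k ⊠ evalMono m) (S.*-identityˡ (evalMono m)) ⟨
      𝟙 ⊠ evalMono m ⊞ N k ⊠ evalMono m        ≈⟨ S.distribʳ (evalMono m) 𝟙 (N k) ⟨
      N (suc k) ⊠ evalMono m                   ∎
      where open ≋-Reasoning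

    ∂-const-^ : ∀ w → ∂ (const q ^ w) ≋ 𝟘
    ∂-const-^ w = S.trans (∂-^′ w (const q))
      (S.trans (⊠-congˡ (N w) (S.trans (⊠-congˡ (const q ^ (w ∸ 1)) (∂-const q)) (S.zeroʳ _))) (S.zeroʳ _))

    module LeibnizTerms (a b c d : ℕ) where
      open ≋-Reasoning
      open RingSolver powerSeriesRing

      Q Qw Wᵃ Xᵇ Yᶜ Zᵈ : Series
      Q  = const q
      Qw = Q ^ ⌊ c ℕ.+ d /2⌋
      Wᵃ = W ^ a
      Xᵇ = X ^ b
      Yᶜ = Y ^ c
      Zᵈ = Z ^ d
      rest₃ rest₄ : Series
      rest₃ = Wᵃ ⊠ X ^ suc b ⊠ Y ^ (c ∸ 1) ⊠ Z ^ suc d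
      rest₄ = Wᵃ ⊠ X ^ suc b ⊠ Y ^ suc c ⊠ Z ^ (d ∸ 1)
      reflexive-index : ∀ {w w′} → w ≡.≡ w′ → Q ^ w ≋ Q ^ w′
      reflexive-index ≡.refl = S.refl
      m₁ m₂ m₃ m₄ : Monomial
      m₁ = W^ a X^ suc b Y^ c Z^ d
      m₂ = W^ a X^ (b ∸ 1) Y^ suc c Z^ suc d
      m₃ = W^ a X^ suc b Y^ (c ∸ 1) Z^ suc d
      m₄ = W^ a X^ suc b Y^ suc c Z^ (d ∸ 1)
      split : evalList (derive (W^ a X^ b Y^ c Z^ d)) ≋
              N a ⊠ evalMono m₁ ⊞ (N b ⊠ evalMono m₂ ⊞ (N c ⊠ evalMono m₃ ⊞ N d ⊠ evalMono m₄))
      split = S.trans (evalList-++ (replicate a m₁) _) (⊞-cong (evalList-replicate a m₁)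
             (S.trans (evalList-++ (replicate b m₂) _) (⊞-cong (evalList-replicate b m₂)
             (S.trans (evalList-++ (replicate c m₃) _) (⊞-cong (evalList-replicate c m₃) (evalList-replicate d m₄))))))
      W-term : Qw ⊠ ∂ Wᵃ ⊠ Xᵇ ⊠ Yᶜ ⊠ Zᵈ ≋ N a ⊠ evalMono m₁
      W-term = begin
        Qw ⊠ ∂ Wᵃ ⊠ Xᵇ ⊠ Yᶜ ⊠ Zᵈ
          ≈⟨ ⊠-congʳ Zᵈ (⊠-congʳ Yᶜ (⊠-congʳ Xᵇ (⊠-congˡ Qw (S.trans (∂-^′ a W) (⊠-congˡ (N a) (⊠-congˡ (W ^ (a ∸ 1)) ∂W)))))) ⟩
        Qw ⊠ (N a ⊠ (W ^ (a ∸ 1) ⊠ (X ⊠ W))) ⊠ Xᵇ ⊠ Yᶜ ⊠ Zᵈ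
          ≈⟨ solve 8 (λ Qw Na Wp X W Xb Yc Zd → Qw :* (Na :* (Wp :* (X :* W))) :* Xb :* Yc :* Zd
                                             := (Na :* (Wp :* W)) :* (Qw :* X :* Xb :* Yc :* Zd)) S.refl Qw (N a) (W ^ (a ∸ 1)) X W Xᵇ Yᶜ Zᵈ ⟩
        (N a ⊠ (W ^ (a ∸ 1) ⊠ W)) ⊠ (Qw ⊠ X ⊠ Xᵇ ⊠ Yᶜ ⊠ Zᵈ)
          ≈⟨ ⊠-congʳ (Qw ⊠ X ⊠ Xᵇ ⊠ Yᶜ ⊠ Zᵈ) (N-^-pred a W) ⟩
        (N a ⊠ Wᵃ) ⊠ (Qw ⊠ X ⊠ Xᵇ ⊠ Yᶜ ⊠ Zᵈ)
          ≈⟨ solve 7 (λ Na Wa Qw X Xb Yc Zd → (Na :* Wa) :* (Qw :* X :* Xb :* Yc :* Zd)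
                       := Na :* (Qw :* Wa :* (X :* Xb) :* Yc :* Zd)) S.refl (N a) Wᵃ Qw X Xᵇ Yᶜ Zᵈ ⟩
        N a ⊠ evalMono m₁ ∎
      X-term : Qw ⊠ Wᵃ ⊠ ∂ Xᵇ ⊠ Yᶜ ⊠ Zᵈ ≋ N b ⊠ evalMono m₂
      X-term = begin
        Qw ⊠ Wᵃ ⊠ ∂ Xᵇ ⊠ Yᶜ ⊠ Zᵈ
          ≈⟨ ⊠-congʳ Zᵈ (⊠-congʳ Yᶜ (⊠-congˡ (Qw ⊠ Wᵃ) (S.trans (∂-^′ b X) (⊠-congˡ (N b) (⊠-congˡ (X ^ (b ∸ 1)) ∂X))))) ⟩
        Qw ⊠ Wᵃ ⊠ (N b ⊠ (X ^ (b ∸ 1) ⊠ (Q ⊠ Y ⊠ Z))) ⊠ Yᶜ ⊠ Zᵈ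
          ≈⟨ solve 9 (λ Qw Wa Nb Xp Q Y Z Yc Zd → Qw :* Wa :* (Nb :* (Xp :* (Q :* Y :* Z))) :* Yc :* Zd
                                               := Nb :* ((Q :* Qw) :* Wa :* Xp :* (Y :* Yc) :* (Z :* Zd))) S.refl Qw Wᵃ (N b) (X ^ (b ∸ 1)) Q Y Z Yᶜ Zᵈ ⟩
        N b ⊠ ((Q ⊠ Qw) ⊠ Wᵃ ⊠ X ^ (b ∸ 1) ⊠ (Y ⊠ Yᶜ) ⊠ (Z ⊠ Zᵈ))
          ≡⟨ ≡.cong (λ w → N b ⊠ (Q ^ w ⊠ Wᵃ ⊠ X ^ (b ∸ 1) ⊠ (Y ⊠ Yᶜ) ⊠ (Z ⊠ Zᵈ))) (≡.cong ⌊_/2⌋ (ℕ.+-suc (suc c) d)) ⟨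
        N b ⊠ evalMono m₂ ∎
      Y-term : Qw ⊠ Wᵃ ⊠ Xᵇ ⊠ ∂ Yᶜ ⊠ Zᵈ ≋ N c ⊠ evalMono m₃
      Y-term = begin
        Qw ⊠ Wᵃ ⊠ Xᵇ ⊠ ∂ Yᶜ ⊠ Zᵈ
          ≈⟨ ⊠-congʳ Zᵈ (⊠-congˡ (Qw ⊠ Wᵃ ⊠ Xᵇ) (S.trans (∂-^′ c Y) (⊠-congˡ (N c) (⊠-congˡ (Y ^ (c ∸ 1)) ∂Y)))) ⟩
        Qw ⊠ Wᵃ ⊠ Xᵇ ⊠ (N c ⊠ (Y ^ (c ∸ 1) ⊠ (X ⊠ Z))) ⊠ Zᵈ
          ≈⟨ solve 8 (λ Qw Wa Xb Nc Yp X Z Zd → Qw :* Wa :* Xb :* (Nc :* (Yp :* (X :* Z))) :* Zd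
                                             := Nc :* (Qw :* (Wa :* (X :* Xb) :* Yp :* (Z :* Zd)))) S.refl Qw Wᵃ Xᵇ (N c) (Y ^ (c ∸ 1)) X Z Zᵈ ⟩
        N c ⊠ (Qw ⊠ (Wᵃ ⊠ X ^ suc b ⊠ Y ^ (c ∸ 1) ⊠ Z ^ suc d))
          ≈⟨ N-⊠-cong c {Qw ⊠ rest₃} {Q ^ ⌊ (c ∸ 1) ℕ.+ suc d /2⌋ ⊠ rest₃}
                        (λ { {c′} ≡.refl → ⊠-congʳ rest₃ (reflexive-index (≡.cong ⌊_/2⌋ (≡.sym (ℕ.+-suc c′ d)))) }) ⟩
        N c ⊠ (Q ^ ⌊ (c ∸ 1) ℕ.+ suc d /2⌋ ⊠ (Wᵃ ⊠ X ^ suc b ⊠ Y ^ (c ∸ 1) ⊠ Z ^ suc d))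
          ≈⟨ ⊠-congˡ (N c) (S.sym (solve 5 (λ a b c d e → a :* b :* c :* d :* e
                                             := a :* (b :* c :* d :* e)) S.refl _ Wᵃ (X ^ suc b) (Y ^ (c ∸ 1)) (Z ^ suc d))) ⟩
        N c ⊠ evalMono m₃ ∎
      Z-term : Qw ⊠ Wᵃ ⊠ Xᵇ ⊠ Yᶜ ⊠ ∂ Zᵈ ≋ N d ⊠ evalMono m₄
      Z-term = begin
        Qw ⊠ Wᵃ ⊠ Xᵇ ⊠ Yᶜ ⊠ ∂ Zᵈ
          ≈⟨ ⊠-congˡ (Qw ⊠ Wᵃ ⊠ Xᵇ ⊠ Yᶜ) (S.trans (∂-^′ d Z) (⊠-congˡ (N d) (⊠-congˡ (Z ^ (d ∸ 1)) ∂Z))) ⟩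
        Qw ⊠ Wᵃ ⊠ Xᵇ ⊠ Yᶜ ⊠ (N d ⊠ (Z ^ (d ∸ 1) ⊠ (X ⊠ Y)))
          ≈⟨ solve 8 (λ Qw Wa Xb Yc Nd Zp X Y → Qw :* Wa :* Xb :* Yc :* (Nd :* (Zp :* (X :* Y)))
                                             := Nd :* (Qw :* (Wa :* (X :* Xb) :* (Y :* Yc) :* Zp))) S.refl Qw Wᵃ Xᵇ Yᶜ (N d) (Z ^ (d ∸ 1)) X Y ⟩
        N d ⊠ (Qw ⊠ (Wᵃ ⊠ X ^ suc b ⊠ Y ^ suc c ⊠ Z ^ (d ∸ 1)))
          ≈⟨ N-⊠-cong d {Qw ⊠ rest₄} {Q ^ ⌊ suc c ℕ.+ (d ∸ 1) /2⌋ ⊠ rest₄}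
                        (λ { {d′} ≡.refl → ⊠-congʳ rest₄ (reflexive-index (≡.cong ⌊_/2⌋ (ℕ.+-suc c d′))) }) ⟩
        N d ⊠ (Q ^ ⌊ suc c ℕ.+ (d ∸ 1) /2⌋ ⊠ (Wᵃ ⊠ X ^ suc b ⊠ Y ^ suc c ⊠ Z ^ (d ∸ 1)))
          ≈⟨ ⊠-congˡ (N d) (S.sym (solve 5 (λ a b c d e → a :* b :* c :* d :* e
                                             := a :* (b :* c :* d :* e)) S.refl _ Wᵃ (X ^ suc b) (Y ^ suc c) (Z ^ (d ∸ 1)))) ⟩
        N d ⊠ evalMono m₄ ∎

    ∂-evalMono : ∀ m → ∂ (evalMono m) ≋ evalList (derive m)
    ∂-evalMono (W^ a X^ b Y^ c Z^ d) = begin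
      ∂ (Qw ⊠ Wᵃ ⊠ Xᵇ ⊠ Yᶜ ⊠ Zᵈ)                    ≈⟨ ∂-⊠⁵ Qw Wᵃ Xᵇ Yᶜ Zᵈ (∂-const-^ ⌊ c ℕ.+ d /2⌋) ⟩
      Qw ⊠ ∂ Wᵃ ⊠ Xᵇ ⊠ Yᶜ ⊠ Zᵈ ⊞ Qw ⊠ Wᵃ ⊠ ∂ Xᵇ ⊠ Yᶜ ⊠ Zᵈ ⊞ Qw ⊠ Wᵃ ⊠ Xᵇ ⊠ ∂ Yᶜ ⊠ Zᵈ ⊞ Qw ⊠ Wᵃ ⊠ Xᵇ ⊠ Yᶜ ⊠ ∂ Zᵈ
                                                    ≈⟨ ⊞-cong (⊞-cong (⊞-cong W-term X-term) Y-term) Z-term ⟩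
      N a ⊠ evalMono m₁ ⊞ N b ⊠ evalMono m₂ ⊞ N c ⊠ evalMono m₃ ⊞ N d ⊠ evalMono m₄
                                                    ≈⟨ S.trans (S.+-assoc _ _ _) (S.+-assoc _ _ _) ⟩
      N a ⊠ evalMono m₁ ⊞ (N b ⊠ evalMono m₂ ⊞ (N c ⊠ evalMono m₃ ⊞ N d ⊠ evalMono m₄))
                                                    ≈⟨ split ⟨
      evalList (derive (W^ a X^ b Y^ c Z^ d))       ∎
      where
      open ≋-Reasoning
      open LeibnizTerms a b c d

    ∂-evalList : ∀ L → ∂ (evalList L) ≋ evalList (concatMap derive L)
    ∂-evalList []      = ∂-const 0#
    ∂-evalList (m ∷ L) = S.trans (∂-⊞ (evalMono m) (evalList L))
      (S.trans (⊞-cong (∂-evalMono m) (∂-evalList L)) (S.sym (evalList-++ (derive m) (concatMap derive L))))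

    evalList-Dⁿ[W] : ∀ n → evalList (Dⁿ[W] n) ≋ ∂ⁿ n W
    evalList-Dⁿ[W] zero    = S.trans (S.+-identityʳ _) (S.trans (S.*-identityʳ _) (S.trans (S.*-identityʳ _)
                               (S.trans (S.*-identityʳ _) (S.trans (S.*-identityˡ _) (S.*-identityʳ W)))))
    evalList-Dⁿ[W] (suc n) = S.trans (S.sym (∂-evalList (Dⁿ[W] n))) (∂-cong (evalList-Dⁿ[W] n))

    module AtZero (W0≈1 : W 0 ≈ 1#) (X0≈1 : X 0 ≈ 1#) (Y0≈0 : Y 0 ≈ 0#) (Z0≈1 : Z 0 ≈ 1#) where

      value : Monomial → Carrier
      value (W^ a X^ b Y^ zero  Z^ d) = (const q ^ ⌊ d /2⌋) 0
      value (W^ a X^ b Y^ suc c Z^ d) = 0#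

      ^-0≈1 : ∀ r {g} → g 0 ≈ 1# → (g ^ r) 0 ≈ 1#
      ^-0≈1 zero    g0≈1 = refl
      ^-0≈1 (suc r) g0≈1 = trans (*-cong g0≈1 (^-0≈1 r g0≈1)) (*-identityˡ 1#)

      evalMono-0 : ∀ m → evalMono m 0 ≈ value m
      evalMono-0 (W^ a X^ b Y^ zero Z^ d) =
        trans (*-cong (*-cong (*-cong (*-cong refl (^-0≈1 a W0≈1)) (^-0≈1 b X0≈1)) refl) (^-0≈1 d Z0≈1))
              (trans (*-identityʳ _) (trans (*-identityʳ _) (trans (*-identityʳ _) (*-identityʳ _))))
      evalMono-0 (W^ a X^ b Y^ suc c Z^ d) = trans (*-cong (trans (*-cong refl (trans (*-cong Y0≈0 refl) (zeroˡ _))) (zeroʳ _)) refl) (zeroˡ _)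

      valueSum : List Monomial → Carrier
      valueSum = List.foldr (λ m x → value m + x) 0#

      evalList-0 : ∀ L → evalList L 0 ≈ valueSum L
      evalList-0 []      = refl
      evalList-0 (m ∷ L) = +-cong (evalMono-0 m) (evalList-0 L)

      n!W[n]≈valueSum : ∀ n → (n ℕ.!) × W n ≈ valueSum (Dⁿ[W] n)
      n!W[n]≈valueSum n = trans (sym (∂ⁿ-0 n W)) (trans (sym (coeff (evalList-Dⁿ[W] n) 0)) (evalList-0 (Dⁿ[W] n)))

module MonomialCounting where
  open import Data.Nat using (_+_; _*_)
  open import Relation.Binary.PropositionalEquality using (_≡_; _≢_; refl; cong; cong₂; sym; trans)
  open import Relation.Nullary using (yes; no)
  open import Data.Nat.Properties using (*-zeroʳ; *-distribˡ-+; +-assoc; +-identityʳ; m+n∸n≡m)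
  open import Data.Nat.Tactic.RingSolver using (solve-∀)
  open import Data.Nat using (parity)
  open import Data.Parity.Base using (_⁻¹; 0ℙ)
  open import Data.Parity.Properties using (⁻¹-injective; suc-homo-⁻¹)
  open import Data.Product using (_×_; _,_)
  open import Data.List.Relation.Unary.All using (All; []; _∷_)
  open import Data.List.Relation.Unary.All.Properties using (++⁺; replicate⁺)

  Poly4ℕ : Set
  Poly4ℕ = ℕ → ℕ → ℕ → ℕ → ℕ

  δ : ℕ → ℕ → ℕ
  δ zero    zero    = 1
  δ zero    (suc _) = 0
  δ (suc _) zero    = 0
  δ (suc m) (suc n) = δ m n

  δ-scale : ∀ x y K → x * (δ x y * K) ≡ y * (δ x y * K)
  δ-scale zero    zero    K = refl
  δ-scale zero    (suc y) K = sym (*-zeroʳ (suc y))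
  δ-scale (suc x) zero    K = *-zeroʳ (suc x)
  δ-scale (suc x) (suc y) K = cong (δ x y * K +_) (δ-scale x y K)

  multiplicity : Monomial → Poly4ℕ
  multiplicity (W^ a X^ b Y^ c Z^ d) a′ b′ c′ d′ = δ a a′ * (δ b b′ * (δ c c′ * δ d d′))

  count : List Monomial → Poly4ℕ
  count []      a b c d = 0
  count (m ∷ L) a b c d = multiplicity m a b c d + count L a b c d

  count-++ : ∀ L L′ a b c d → count (L ++ L′) a b c d ≡ count L a b c d + count L′ a b c d
  count-++ []      L′ a b c d = refl
  count-++ (m ∷ L) L′ a b c d = trans (cong (multiplicity m a b c d +_) (count-++ L L′ a b c d))
                                      (sym (+-assoc (multiplicity m a b c d) (count L a b c d) (count L′ a b c d)))

  count-replicate : ∀ k m a b c d → count (replicate k m) a b c d ≡ k * multiplicity m a b c d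
  count-replicate zero    m a b c d = refl
  count-replicate (suc k) m a b c d = cong (multiplicity m a b c d +_) (count-replicate k m a b c d)

  -- An ℕ-valued copy of D from Defs, so that the counting below stays in ℕ.
  dWℕ dXℕ dYℕ dZℕ Dℕ : Poly4ℕ → Poly4ℕ
  dWℕ p a zero    c d = 0
  dWℕ p a (suc b) c d = a * p a b c d
  dXℕ p a b (suc c) (suc d) = suc b * p a (suc b) c d
  dXℕ p a b _       _       = 0
  dYℕ p a (suc b) c (suc d) = suc c * p a b (suc c) d
  dYℕ p a _       _ _       = 0
  dZℕ p a (suc b) (suc c) d = suc d * p a b c (suc d)
  dZℕ p a _       _       _ = 0
  Dℕ p a b c d = dWℕ p a b c d + (dXℕ p a b c d + (dYℕ p a b c d + dZℕ p a b c d))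

  Dℕ-+ : ∀ p p′ a b c d → Dℕ (λ a b c d → p a b c d + p′ a b c d) a b c d ≡ Dℕ p a b c d + Dℕ p′ a b c d
  Dℕ-+ p p′ a b c d =
    trans (cong₂ _+_ (w b) (cong₂ _+_ (x b c d) (cong₂ _+_ (y b c d) (z b c d))))
          (shuffle (dWℕ p a b c d) (dWℕ p′ a b c d) (dXℕ p a b c d) (dXℕ p′ a b c d)
                   (dYℕ p a b c d) (dYℕ p′ a b c d) (dZℕ p a b c d) (dZℕ p′ a b c d))
    where
    shuffle : ∀ w w′ x x′ y y′ z z′ →
              (w + w′) + ((x + x′) + ((y + y′) + (z + z′))) ≡ (w + (x + (y + z))) + (w′ + (x′ + (y′ + z′)))
    shuffle = solve-∀
    p+p′ : Poly4ℕ
    p+p′ a b c d = p a b c d + p′ a b c d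
    w : ∀ b → dWℕ p+p′ a b c d ≡ dWℕ p a b c d + dWℕ p′ a b c d
    w zero    = refl
    w (suc b) = *-distribˡ-+ a (p a b c d) (p′ a b c d)
    x : ∀ b c d → dXℕ p+p′ a b c d ≡ dXℕ p a b c d + dXℕ p′ a b c d
    x b zero    d       = refl
    x b (suc c) zero    = refl
    x b (suc c) (suc d) = *-distribˡ-+ (suc b) (p a (suc b) c d) (p′ a (suc b) c d)
    y : ∀ b c d → dYℕ p+p′ a b c d ≡ dYℕ p a b c d + dYℕ p′ a b c d
    y zero    c d       = refl
    y (suc b) c zero    = refl
    y (suc b) c (suc d) = *-distribˡ-+ (suc c) (p a b (suc c) d) (p′ a b (suc c) d)
    z : ∀ b c d → dZℕ p+p′ a b c d ≡ dZℕ p a b c d + dZℕ p′ a b c d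
    z zero    c       d = refl
    z (suc b) zero    d = refl
    z (suc b) (suc c) d = *-distribˡ-+ (suc d) (p a b c (suc d)) (p′ a b c (suc d))

  Dℕ-0 : ∀ a b c d → Dℕ (λ _ _ _ _ → 0) a b c d ≡ 0
  Dℕ-0 a b c d = cong₂ _+_ (w b) (cong₂ _+_ (x b c d) (cong₂ _+_ (y b c d) (z b c d)))
    where
    p : Poly4ℕ
    p _ _ _ _ = 0
    w : ∀ b → dWℕ p a b c d ≡ 0
    w zero    = refl
    w (suc b) = *-zeroʳ a
    x : ∀ b c d → dXℕ p a b c d ≡ 0
    x b zero    d       = refl
    x b (suc c) zero    = refl
    x b (suc c) (suc d) = *-zeroʳ (suc b)
    y : ∀ b c d → dYℕ p a b c d ≡ 0
    y zero    c d       = refl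
    y (suc b) c zero    = refl
    y (suc b) c (suc d) = *-zeroʳ (suc c)
    z : ∀ b c d → dZℕ p a b c d ≡ 0
    z zero    c       d = refl
    z (suc b) zero    d = refl
    z (suc b) (suc c) d = *-zeroʳ (suc d)

  private
    zero₂ : ∀ k A → k * (A * 0) ≡ 0
    zero₂ = solve-∀
    zero₃ : ∀ k A B → k * (A * (B * 0)) ≡ 0
    zero₃ = solve-∀
    zero₄ : ∀ k A B C → k * (A * (B * (C * 0))) ≡ 0
    zero₄ = solve-∀
    swap₂ : ∀ k A D K → k * (A * (D * K)) ≡ k * (D * (A * K))
    swap₂ = solve-∀
    swap₃ : ∀ k A B D K → k * (A * (B * (D * K))) ≡ k * (D * (A * (B * K)))
    swap₃ = solve-∀
    swap₄ : ∀ k A B C D → k * (A * (B * (C * D))) ≡ k * (D * (A * (B * C)))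
    swap₄ = solve-∀

  dWℕ-multiplicity : ∀ a b c d a′ b′ c′ d′ → dWℕ (multiplicity (W^ a X^ b Y^ c Z^ d)) a′ b′ c′ d′ ≡
                                             a * multiplicity (W^ a X^ suc b Y^ c Z^ d) a′ b′ c′ d′
  dWℕ-multiplicity a b c d a′ zero     c′ d′ = sym (zero₂ a (δ a a′))
  dWℕ-multiplicity a b c d a′ (suc b′) c′ d′ = sym (δ-scale a a′ _)

  dXℕ-multiplicity : ∀ a b c d a′ b′ c′ d′ → dXℕ (multiplicity (W^ a X^ b Y^ c Z^ d)) a′ b′ c′ d′ ≡
                                             b * multiplicity (W^ a X^ (b ∸ 1) Y^ suc c Z^ suc d) a′ b′ c′ d′
  dXℕ-multiplicity a b       c d a′ b′ zero     d′       = sym (zero₃ b (δ a a′) (δ (b ∸ 1) b′))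
  dXℕ-multiplicity a b       c d a′ b′ (suc c′) zero     = sym (zero₄ b (δ a a′) (δ (b ∸ 1) b′) (δ c c′))
  dXℕ-multiplicity a zero    c d a′ b′ (suc c′) (suc d′) = zero₂ (suc b′) (δ a a′)
  dXℕ-multiplicity a (suc b) c d a′ b′ (suc c′) (suc d′) =
    trans (swap₂ (suc b′) (δ a a′) (δ b b′) _)
          (trans (sym (δ-scale (suc b) (suc b′) _)) (sym (swap₂ (suc b) (δ a a′) (δ b b′) _)))

  dYℕ-multiplicity : ∀ a b c d a′ b′ c′ d′ → dYℕ (multiplicity (W^ a X^ b Y^ c Z^ d)) a′ b′ c′ d′ ≡
                                             c * multiplicity (W^ a X^ suc b Y^ (c ∸ 1) Z^ suc d) a′ b′ c′ d′
  dYℕ-multiplicity a b c       d a′ zero     c′ d′       = sym (zero₂ c (δ a a′))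
  dYℕ-multiplicity a b c       d a′ (suc b′) c′ zero     = sym (zero₄ c (δ a a′) (δ b b′) (δ (c ∸ 1) c′))
  dYℕ-multiplicity a b zero    d a′ (suc b′) c′ (suc d′) = zero₃ (suc c′) (δ a a′) (δ b b′)
  dYℕ-multiplicity a b (suc c) d a′ (suc b′) c′ (suc d′) =
    trans (swap₃ (suc c′) (δ a a′) (δ b b′) (δ c c′) _)
          (trans (sym (δ-scale (suc c) (suc c′) _)) (sym (swap₃ (suc c) (δ a a′) (δ b b′) (δ c c′) _)))

  dZℕ-multiplicity : ∀ a b c d a′ b′ c′ d′ → dZℕ (multiplicity (W^ a X^ b Y^ c Z^ d)) a′ b′ c′ d′ ≡
                                             d * multiplicity (W^ a X^ suc b Y^ suc c Z^ (d ∸ 1)) a′ b′ c′ d′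
  dZℕ-multiplicity a b c d       a′ zero     c′       d′ = sym (zero₂ d (δ a a′))
  dZℕ-multiplicity a b c d       a′ (suc b′) zero     d′ = sym (zero₃ d (δ a a′) (δ b b′))
  dZℕ-multiplicity a b c zero    a′ (suc b′) (suc c′) d′ = zero₄ (suc d′) (δ a a′) (δ b b′) (δ c c′)
  dZℕ-multiplicity a b c (suc d) a′ (suc b′) (suc c′) d′ =
    trans (swap₄ (suc d′) (δ a a′) (δ b b′) (δ c c′) (δ d d′))
          (trans (sym (δ-scale (suc d) (suc d′) _)) (sym (swap₄ (suc d) (δ a a′) (δ b b′) (δ c c′) (δ d d′))))

  Dℕ-multiplicity : ∀ m a′ b′ c′ d′ → Dℕ (multiplicity m) a′ b′ c′ d′ ≡ count (derive m) a′ b′ c′ d′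
  Dℕ-multiplicity (W^ a X^ b Y^ c Z^ d) a′ b′ c′ d′ = sym (begin
    cnt (derive (W^ a X^ b Y^ c Z^ d))
      ≡⟨ count-++ (replicate a m₁) _ a′ b′ c′ d′ ⟩
    cnt (replicate a m₁) + cnt (replicate b m₂ ++ (replicate c m₃ ++ replicate d m₄))
      ≡⟨ cong (cnt (replicate a m₁) +_) (count-++ (replicate b m₂) _ a′ b′ c′ d′) ⟩
    cnt (replicate a m₁) + (cnt (replicate b m₂) + cnt (replicate c m₃ ++ replicate d m₄))
      ≡⟨ cong (λ r → cnt (replicate a m₁) + (cnt (replicate b m₂) + r)) (count-++ (replicate c m₃) _ a′ b′ c′ d′) ⟩
    cnt (replicate a m₁) + (cnt (replicate b m₂) + (cnt (replicate c m₃) + cnt (replicate d m₄)))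
      ≡⟨ cong₂ _+_ (trans (count-replicate a m₁ a′ b′ c′ d′) (sym (dWℕ-multiplicity a b c d a′ b′ c′ d′)))
          (cong₂ _+_ (trans (count-replicate b m₂ a′ b′ c′ d′) (sym (dXℕ-multiplicity a b c d a′ b′ c′ d′)))
           (cong₂ _+_ (trans (count-replicate c m₃ a′ b′ c′ d′) (sym (dYℕ-multiplicity a b c d a′ b′ c′ d′)))
                      (trans (count-replicate d m₄ a′ b′ c′ d′) (sym (dZℕ-multiplicity a b c d a′ b′ c′ d′))))) ⟩
    Dℕ (multiplicity (W^ a X^ b Y^ c Z^ d)) a′ b′ c′ d′ ∎)
    where
    open ≡.≡-Reasoning
    cnt : List Monomial → ℕ
    cnt L = count L a′ b′ c′ d′
    m₁ m₂ m₃ m₄ : Monomial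
    m₁ = W^ a X^ suc b Y^ c Z^ d
    m₂ = W^ a X^ (b ∸ 1) Y^ suc c Z^ suc d
    m₃ = W^ a X^ suc b Y^ (c ∸ 1) Z^ suc d
    m₄ = W^ a X^ suc b Y^ suc c Z^ (d ∸ 1)

  Dℕ-count : ∀ L a b c d → Dℕ (count L) a b c d ≡ count (concatMap derive L) a b c d
  Dℕ-count []      a b c d = Dℕ-0 a b c d
  Dℕ-count (m ∷ L) a b c d = trans (Dℕ-+ (multiplicity m) (count L) a b c d)
    (trans (cong₂ _+_ (Dℕ-multiplicity m a b c d) (Dℕ-count L a b c d)) (sym (count-++ (derive m) (concatMap derive L) a b c d)))

  HasShape : ℕ → Monomial → Set
  HasShape n (W^ a X^ b Y^ c Z^ d) = a ≡ 1 × b + c + d ≡ n × parity b ≡ parity n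

  derive-shape : ∀ n m → HasShape n m → All (HasShape (suc n)) (derive m)
  derive-shape n (W^ a X^ b Y^ c Z^ d) (refl , b+c+d≡n , b≡n) =
    ++⁺ (replicate⁺ 1 (refl , cong suc b+c+d≡n , parity-step))
        (++⁺ (X-move b b+c+d≡n b≡n) (++⁺ (Y-move c b+c+d≡n) (Z-move d b+c+d≡n)))
    where
    parity-step : parity (suc b) ≡ parity (suc n)
    parity-step = trans (parity-suc b) (trans (cong _⁻¹ b≡n) (sym (parity-suc n)))
    X-move : ∀ b → b + c + d ≡ n → parity b ≡ parity n → All (HasShape (suc n)) (replicate b (W^ 1 X^ (b ∸ 1) Y^ suc c Z^ suc d))
    X-move zero    _ _ = []
    X-move (suc b) s p = replicate⁺ (suc b) (refl , trans (moved b c d) (cong suc s) , ⁻¹-injective (trans (sym (parity-suc b)) (trans p (sym (suc-homo-⁻¹ n)))))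
      where
      moved : ∀ b c d → b + suc c + suc d ≡ suc (suc b + c + d)
      moved = solve-∀
    Y-move : ∀ c → b + c + d ≡ n → All (HasShape (suc n)) (replicate c (W^ 1 X^ suc b Y^ (c ∸ 1) Z^ suc d))
    Y-move zero    _ = []
    Y-move (suc c) s = replicate⁺ (suc c) (refl , trans (moved b c d) (cong suc s) , parity-step)
      where
      moved : ∀ b c d → suc b + c + suc d ≡ suc (b + suc c + d)
      moved = solve-∀
    Z-move : ∀ d → b + c + d ≡ n → All (HasShape (suc n)) (replicate d (W^ 1 X^ suc b Y^ suc c Z^ (d ∸ 1)))
    Z-move zero    _ = []
    Z-move (suc d) s = replicate⁺ (suc d) (refl , trans (moved b c d) (cong suc s) , parity-step)
      where
      moved : ∀ b c d → suc b + suc c + d ≡ suc (b + c + suc d)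
      moved = solve-∀

  Dⁿ[W]-shape : ∀ n → All (HasShape n) (Dⁿ[W] n)
  Dⁿ[W]-shape zero    = (refl , refl , refl) ∷ []
  Dⁿ[W]-shape (suc n) = concatMap-derive (Dⁿ[W] n) (Dⁿ[W]-shape n)
    where
    concatMap-derive : ∀ L → All (HasShape n) L → All (HasShape (suc n)) (concatMap derive L)
    concatMap-derive []      []         = []
    concatMap-derive (m ∷ L) (sm ∷ sL) = ++⁺ (derive-shape n m sm) (concatMap-derive L sL)

  δ-refl : ∀ x → δ x x ≡ 1
  δ-refl zero    = refl
  δ-refl (suc x) = δ-refl x

  δ-≢ : ∀ {x y} → x ≢ y → δ x y ≡ 0
  δ-≢ {zero}  {zero}  x≢y = ⊥-elim (x≢y refl)
  δ-≢ {zero}  {suc y} _   = refl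
  δ-≢ {suc x} {zero}  _   = refl
  δ-≢ {suc x} {suc y} x≢y = δ-≢ (x≢y ∘ cong suc)

  qCoefficient : ℕ → Monomial → ℕ
  qCoefficient i (W^ a X^ b Y^ zero  Z^ d) = δ ⌊ d /2⌋ i
  qCoefficient i (W^ a X^ b Y^ suc c Z^ d) = 0

  qCoefficient≡multiplicity : ∀ n i m → HasShape n m → qCoefficient i m ≡ multiplicity m 1 (n ∸ 2 * i) 0 (2 * i)
  qCoefficient≡multiplicity n i (W^ a X^ b Y^ suc c Z^ d) (refl , _) = sym (vanish (δ b (n ∸ 2 * i)))
    where
    vanish : ∀ x → 1 * (x * 0) ≡ 0
    vanish = solve-∀
  qCoefficient≡multiplicity n i (W^ a X^ b Y^ zero Z^ d) (refl , b+d≡n , b≡n) with d ℕ.≟ 2 * i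
  ... | yes refl = trans (cong (λ k → δ k i) (⌊2*n/2⌋≡n i))
                         (trans (δ-refl i) (sym (cong₂ (λ x y → 1 * (x * (1 * y))) b≡n∸2i (δ-refl (2 * i)))))
    where
    b≡n∸2i : δ b (n ∸ 2 * i) ≡ 1
    b≡n∸2i = trans (cong (δ b) (trans (cong (_∸ 2 * i) (sym b+d≡n)) (trans (m+n∸n≡m (b + 0) (2 * i)) (+-identityʳ b)))) (δ-refl b)
  ... | no  d≢2i = trans (δ-≢ {⌊ d /2⌋} {i} (λ ⌊d/2⌋≡i → d≢2i (trans (sym (even⇒≡2*⌊n/2⌋ d-even)) (cong (2 *_) ⌊d/2⌋≡i))))
                         (sym (trans (cong (λ y → 1 * (δ b (n ∸ 2 * i) * (1 * y))) (δ-≢ d≢2i)) (vanish (δ b (n ∸ 2 * i)))))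
    where
    vanish : ∀ x → 1 * (x * (1 * 0)) ≡ 0
    vanish = solve-∀
    d-even : parity d ≡ 0ℙ
    d-even = parity-+-cancel {b} {d} (trans b≡n (cong parity (trans (sym b+d≡n) (cong (_+ d) (+-identityʳ b)))))

  qCoefficientSum : ℕ → List Monomial → ℕ
  qCoefficientSum i = List.foldr (λ m k → qCoefficient i m + k) 0

  qCoefficientSum≡count : ∀ n i {L} → All (HasShape n) L → qCoefficientSum i L ≡ count L 1 (n ∸ 2 * i) 0 (2 * i)
  qCoefficientSum≡count n i []                  = refl
  qCoefficientSum≡count n i {m ∷ L} (sm ∷ sL) = cong₂ _+_ (qCoefficient≡multiplicity n i m sm) (qCoefficientSum≡count n i sL)

module RationalFacts where
  open import Defs
  open import Data.Integer using (+_)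
  open import Data.Rational using (ℚ; 0ℚ; 1ℚ; _+_; _*_; _/_)
  import Data.Rational.Properties as ℚ
  open import Relation.Binary.PropositionalEquality using (_≡_; cong; cong₂; sym; trans)
  open import Data.Nat.Divisibility using (∣1⇒≡1)
  import Data.Integer as ℤ
  import Data.Integer.Properties as ℤ
  open import Data.Product using (_,_)
  open import Data.Rational using (mkℚ)

  -- nq n and 1/(1+n) in normal form, where the library's lemmas apply.
  private
    nq′ : ℕ → ℚ
    nq′ n = mkℚ (+ n) 0 (λ { (_ , d) → ∣1⇒≡1 d })

    nq≡nq′ : ∀ n → nq n ≡ nq′ n
    nq≡nq′ n = ℚ.↥p/↧p≡p (nq′ n)

    1/[1+n] : ℕ → ℚ
    1/[1+n] n = mkℚ (+ 1) n (λ { (d , _) → ∣1⇒≡1 d })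

    1/[1+n]≡ : ∀ n → + 1 / suc n ≡ 1/[1+n] n
    1/[1+n]≡ n = ℚ.↥p/↧p≡p (1/[1+n] n)

  nq-+ : ∀ a b → nq (a ℕ.+ b) ≡ nq a + nq b
  nq-+ a b = trans (cong (_/ 1) (trans (ℤ.pos-+ a b) (sym (cong₂ ℤ._+_ (ℤ.*-identityʳ (+ a)) (ℤ.*-identityʳ (+ b))))))
                   (sym (cong₂ _+_ (nq≡nq′ a) (nq≡nq′ b)))

  nq-* : ∀ a b → nq (a ℕ.* b) ≡ nq a * nq b
  nq-* a b = trans (cong (_/ 1) (ℤ.pos-* a b)) (sym (cong₂ _*_ (nq≡nq′ a) (nq≡nq′ b)))

  nq-inverse : ∀ n → nq (suc n) * (+ 1 / suc n) ≡ 1ℚ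
  nq-inverse n = trans (cong₂ _*_ (nq≡nq′ (suc n)) (1/[1+n]≡ n)) (ℚ.*-inverseʳ (nq′ (suc n)))

  ℚ-ring : CommutativeRing 0ℓ 0ℓ
  ℚ-ring = ℚ.+-*-commutativeRing

  open import Algebra.Properties.Semiring.Mult (CommutativeRing.semiring ℚ-ring) using (_×_)

  ×≡nq* : ∀ k x → k × x ≡ nq k * x
  ×≡nq* zero    x = sym (ℚ.*-zeroˡ x)
  ×≡nq* (suc k) x = begin
    x + k × x              ≡⟨ cong₂ _+_ (sym (ℚ.*-identityˡ x)) (×≡nq* k x) ⟩
    1ℚ * x + nq k * x      ≡⟨ ℚ.*-distribʳ-+ x 1ℚ (nq k) ⟨
    (1ℚ + nq k) * x        ≡⟨ cong (_* x) (nq-+ 1 k) ⟨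
    nq (suc k) * x         ∎
    where open ≡.≡-Reasoning

  nq-cancel : ∀ n {x} → nq (suc n) * x ≡ 0ℚ → x ≡ 0ℚ
  nq-cancel n {x} nx≡0 = begin
    x                                    ≡⟨ ℚ.*-identityˡ x ⟨
    1ℚ * x                               ≡⟨ cong (_* x) (trans (sym (nq-inverse n)) (ℚ.*-comm (nq (suc n)) _)) ⟩
    ((+ 1 / suc n) * nq (suc n)) * x     ≡⟨ ℚ.*-assoc (+ 1 / suc n) (nq (suc n)) x ⟩
    (+ 1 / suc n) * (nq (suc n) * x)     ≡⟨ cong ((+ 1 / suc n) *_) nx≡0 ⟩
    (+ 1 / suc n) * 0ℚ                   ≡⟨ ℚ.*-zeroʳ (+ 1 / suc n) ⟩
    0ℚ                                   ∎
    where open ≡.≡-Reasoning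

module EllipticInstance where
  open import Defs
  open import Data.Integer using (+_)
  open import Data.Rational using (ℚ; 0ℚ; 1ℚ; _+_; _*_; -_; _/_)
  import Data.Rational.Properties as ℚ
  open import Relation.Binary.PropositionalEquality using (_≡_; refl; cong; cong₂; sym; trans)
  open import Data.List using ([]; _∷_)
  open import Data.Nat using (_!)
  open RationalFacts
  module 𝒫 = PowerSeries ℚ-ring

  -- Coefficients are power series in q = k²; the J_n(q) are polynomials among them.
  ℚ[[q]] : CommutativeRing 0ℓ 0ℓ
  ℚ[[q]] = 𝒫.powerSeriesRing

  open CommutativeRing ℚ[[q]] using (_≈_; 1#) renaming (_+_ to _⊕_; _*_ to _⊛_)
  open PowerSeries ℚ[[q]] hiding (Series)
  open Composition ℚ[[q]]
  open Derivative ℚ[[q]]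
  open PowerOde ℚ[[q]]
  open Jacobi ℚ[[q]]
  private module S = CommutativeRing powerSeriesRing

  pointwise : ∀ {f g : Series} → (∀ n m → f n m ≡ g n m) → f ≋ g
  pointwise f≡g = coeffwise λ n → 𝒫.coeffwise (f≡g n)

  torsionFree : TorsionFree
  torsionFree n {a} n×a≈0 = 𝒫.coeffwise λ m →
    nq-cancel n (trans (sym (×≡nq* (suc n) (a m))) (trans (sym (𝒫.×ₛ-coeff (suc n) a m)) (𝒫.coeff n×a≈0 m)))

  sumTo≡∑ : ∀ n f → sumTo n f ≡ FiniteSums.∑ ℚ-ring n f
  sumTo≡∑ zero    f = refl
  sumTo≡∑ (suc n) f = cong (_+ f (suc n)) (sumTo≡∑ n f)

  sumTo-cong : ∀ n {f g : ℕ → ℚ} → (∀ j → f j ≡ g j) → sumTo n f ≡ sumTo n g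
  sumTo-cong zero    f≡g = f≡g 0
  sumTo-cong (suc n) f≡g = cong₂ _+_ (sumTo-cong n f≡g) (f≡g (suc n))

  ∑-at : ∀ n (F : ℕ → P) m → FiniteSums.∑ ℚ[[q]] n F m ≡ sumTo n (λ j → F j m)
  ∑-at zero    F m = refl
  ∑-at (suc n) F m = cong (_+ F (suc n) m) (∑-at n F m)

  smul≋⊠ : ∀ f g → smul f g ≋ f ⊠ g
  smul≋⊠ f g = pointwise λ n m → trans (sumTo-cong n (λ j → sumTo≡∑ m _)) (sym (∑-at n (λ j → f j 𝒫.⊠ g (n ∸ j)) m))

  oneS≋𝟙 : oneS ≋ 𝟙
  oneS≋𝟙 = pointwise λ { zero zero → refl ; zero (suc m) → refl ; (suc n) zero → refl ; (suc n) (suc m) → refl }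

  xS≋𝕏 : xS ≋ 𝕏
  xS≋𝕏 = pointwise λ { zero zero → refl ; zero (suc m) → refl ; (suc zero) zero → refl ; (suc zero) (suc m) → refl
                     ; (suc (suc n)) zero → refl ; (suc (suc n)) (suc m) → refl }

  spow≋^ : ∀ g r → spow g r ≋ g ^ r
  spow≋^ g zero    = oneS≋𝟙
  spow≋^ g (suc r) = S.trans (smul≋⊠ g (spow g r)) (⊠-congˡ g (spow≋^ g r))

  compose≋comp : ∀ F g → compose F g ≋ comp F g
  compose≋comp F g = pointwise λ n m →
    trans (sumTo-cong n (λ r → trans (sumTo≡∑ m _) (𝒫.coeff (𝒫.⊠-congˡ (F r) (coeff (spow≋^ g r) n)) m)))
          (sym (∑-at n (λ r → F r 𝒫.⊠ (g ^ r) n) m))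

  invIter≋inverseApprox : ∀ F r → invIter F r ≋ inverseApprox F r
  invIter≋inverseApprox F zero    = pointwise λ { n zero → refl ; n (suc m) → refl }
  invIter≋inverseApprox F (suc r) = ⊞-cong (invIter≋inverseApprox F r) (⊞-cong xS≋𝕏 (⊟-cong
    (S.trans (compose≋comp F (invIter F r)) (comp-cong (S.refl {F}) (invIter≋inverseApprox F r)))))

  snS≋inverse : snS ≋ inverse ellF
  snS≋inverse = pointwise λ n m → 𝒫.coeff (coeff (invIter≋inverseApprox ellF n) n) m

  q̂ : P
  q̂ = 𝒫.𝕏

  module 𝒫R = CommutativeRing ℚ[[q]]

  −k𝕏²-at : ∀ k n m → (⊟ scaledSquare k 𝕏) n m ≡ - (k ⊛ 𝕏 (ℕ.pred n)) m
  −k𝕏²-at k zero    m = cong -_ (trans (𝒫.coeff (𝒫R.zeroʳ ((const k ⊠ 𝕏) 0)) m) (sym (𝒫.coeff (𝒫R.zeroʳ k) m)))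
  −k𝕏²-at k (suc n) m = cong -_ (𝒫.coeff (scaledSquare-𝕏-suc k n) m)

  h₁≋ : h₁ ≋ ⊟ scaledSquare 1# 𝕏
  h₁≋ = pointwise λ n m → trans (at n m) (sym (trans (−k𝕏²-at 1# n m) (cong -_ (𝒫.coeff (𝒫R.*-identityˡ (𝕏 (ℕ.pred n))) m))))
    where
    at : ∀ n m → h₁ n m ≡ - 𝕏 (ℕ.pred n) m
    at zero                zero    = refl
    at zero                (suc m) = refl
    at (suc zero)          zero    = refl
    at (suc zero)          (suc m) = refl
    at (suc (suc zero))    zero    = refl
    at (suc (suc zero))    (suc m) = refl
    at (suc (suc (suc n))) zero    = refl
    at (suc (suc (suc n))) (suc m) = refl

  h₂≋ : h₂ ≋ ⊟ scaledSquare q̂ 𝕏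
  h₂≋ = pointwise λ n m → trans (at n m) (sym (−k𝕏²-at q̂ n m))
    where
    at : ∀ n m → h₂ n m ≡ - (q̂ ⊛ 𝕏 (ℕ.pred n)) m
    vanishing : ∀ m → constP 0ℚ m ≡ - (q̂ ⊛ 𝒫.𝟘) m
    vanishing m = trans (constP0 m) (cong -_ (sym (𝒫.coeff (𝒫R.zeroʳ q̂) m)))
      where
      constP0 : ∀ m → constP 0ℚ m ≡ - 0ℚ
      constP0 zero    = refl
      constP0 (suc m) = refl
    h₂-2 : ∀ m → h₂ 2 m ≡ - q̂ m
    h₂-2 zero          = refl
    h₂-2 (suc zero)    = refl
    h₂-2 (suc (suc m)) = refl
    at zero                m = vanishing m
    at (suc zero)          m = vanishing m
    at (suc (suc zero))    m = trans (h₂-2 m) (cong -_ (sym (𝒫.coeff (𝒫R.*-identityʳ q̂) m)))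
    at (suc (suc (suc n))) m = vanishing m

  B : ℚ → Series
  B α r = constP (gbinom α r)

  gbinom-recurrence : ∀ α n → nq (suc n) * gbinom α (suc n) + nq n * gbinom α n ≡ α * gbinom α n
  gbinom-recurrence α n = begin
    N * (g * ((α - x) * I)) + x * g
      ≡⟨ solve 5 (λ N g α x I → N :* (g :* ((α :- x) :* I)) :+ x :* g := (N :* I) :* (g :* (α :- x)) :+ x :* g) refl N g α x I ⟩
    (N * I) * (g * (α - x)) + x * g   ≡⟨ cong (λ y → y * (g * (α - x)) + x * g) (nq-inverse n) ⟩
    1ℚ * (g * (α - x)) + x * g        ≡⟨ solve 3 (λ g α x → con (+ 1) :* (g :* (α :- x)) :+ x :* g := α :* g) refl g α x ⟩
    α * g                             ∎
    where
    open ≡.≡-Reasoning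
    open RingSolver ℚ-ring
    open import Data.Rational using (_-_)
    N x g I : ℚ
    N = nq (suc n)
    x = nq n
    g = gbinom α n
    I = + 1 / suc n

  B-ode : ∀ α → Ode (𝒫.const α) (𝟙 ⊞ 𝕏) (B α)
  B-ode α = binomial-Ode λ n → 𝒫.coeffwise λ m →
    trans (cong₂ _+_ (trans (𝒫.×ₛ-coeff (suc n) (B α (suc n)) m) (×≡nq* (suc n) _))
                     (trans (𝒫.×ₛ-coeff n (B α n) m) (×≡nq* n _)))
          (trans (at n m) (sym (𝒫.const-⊠ α (B α n) m)))
    where
    at : ∀ n m → nq (suc n) * B α (suc n) m + nq n * B α n m ≡ α * B α n m
    at n zero    = gbinom-recurrence α n
    at n (suc m) = trans (cong₂ _+_ (ℚ.*-zeroʳ (nq (suc n))) (ℚ.*-zeroʳ (nq n))) (sym (ℚ.*-zeroʳ α))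

  B0≈1 : ∀ α → B α 0 ≈ 1#
  B0≈1 α = 𝒫.coeffwise λ { zero → refl ; (suc m) → refl }

  ĥ : P
  ĥ = 𝒫.const half

  ĥ+ĥ≈1 : ĥ ⊕ ĥ ≈ 1#
  ĥ+ĥ≈1 = 𝒫.coeffwise λ { zero → refl ; (suc m) → refl }

  B⁻-ode : Ode (𝒫R.- ĥ) (𝟙 ⊞ 𝕏) (B (- half))
  B⁻-ode = Ode-congᵅ (𝒫.coeffwise λ { zero → refl ; (suc m) → refl }) (B-ode (- half))

  integrand≋ : integrand ≋ comp (B (- half)) (⊟ scaledSquare 1# 𝕏) ⊠ comp (B (- half)) (⊟ scaledSquare q̂ 𝕏)
  integrand≋ = S.trans (smul≋⊠ (binomPow (- half) h₁) (binomPow (- half) h₂)) (⊠-cong (S.trans (compose≋comp (B (- half)) h₁) (comp-cong (S.refl {B (- half)}) h₁≋))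
                                            (S.trans (compose≋comp (B (- half)) h₂) (comp-cong (S.refl {B (- half)}) h₂≋)))

  ∂ellF≋ : ∂ ellF ≋ comp (B (- half)) (⊟ scaledSquare 1# 𝕏) ⊠ comp (B (- half)) (⊟ scaledSquare q̂ 𝕏)
  ∂ellF≋ = S.trans ∂ellF≋integrand integrand≋
    where
    undo : ∀ n x → nq (suc n) * (x * (+ 1 / suc n)) ≡ x
    undo n x = trans (solve 3 (λ N x I → N :* (x :* I) := (N :* I) :* x) refl (nq (suc n)) x (+ 1 / suc n))
                     (trans (cong (_* x) (nq-inverse n)) (ℚ.*-identityˡ x))
      where open RingSolver ℚ-ring
    ∂ellF≋integrand : ∂ ellF ≋ integrand
    ∂ellF≋integrand = pointwise λ n m →
      trans (𝒫.×ₛ-coeff (suc n) (ellF (suc n)) m) (trans (×≡nq* (suc n) _) (undo n (integrand n m)))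

  ellF0≈0 : ellF 0 ≈ 𝒫R.0#
  ellF0≈0 = 𝒫.coeffwise λ m → refl

  ellF1≈1 : ellF 1 ≈ 1#
  ellF1≈1 = 𝒫.coeffwise λ m → trans (ℚ.*-identityʳ (integrand 0 m)) (𝒫.coeff (𝒫R.trans (coeff integrand≋ 0) integrand0≈1) m)
    where
    integrand0≈1 : (comp (B (- half)) (⊟ scaledSquare 1# 𝕏) ⊠ comp (B (- half)) (⊟ scaledSquare q̂ 𝕏)) 0 ≈ 1#
    integrand0≈1 = 𝒫R.trans (𝒫R.*-cong (𝒫R.trans (comp-0 (B (- half)) (⊟ scaledSquare 1# 𝕏)) (B0≈1 (- half)))
                                         (𝒫R.trans (comp-0 (B (- half)) (⊟ scaledSquare q̂ 𝕏)) (B0≈1 (- half))))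
                            (𝒫R.*-identityˡ 1#)

  module Jac = Jacobi.System ℚ[[q]] torsionFree ĥ+ĥ≈1 B⁻-ode (B-ode half) (B0≈1 (- half)) (B0≈1 half) q̂ {ellF} ellF0≈0 ellF1≈1 ∂ellF≋

  cnS≋cn : cnS ≋ Jac.cn
  cnS≋cn = S.trans (compose≋comp (B half) (sneg (smul snS snS))) (comp-cong (S.refl {B half}) (⊟-cong
             (S.trans (smul≋⊠ snS snS) (S.trans (⊠-cong snS≋inverse snS≋inverse) (S.sym (⊠-congʳ Jac.sn (S.*-identityˡ Jac.sn)))))))

  module Value = Evaluation.Along.AtZero ℚ[[q]] q̂ {Jac.X} {Jac.Y} {Jac.Z} {Jac.W} Jac.∂X Jac.∂Y Jac.∂Z Jac.∂W
                   Jac.W0≈1 Jac.X0≈1 Jac.Y0≈0 Jac.Z0≈1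
  open MonomialCounting using (δ; qCoefficient; qCoefficientSum)

  q̂^-0 : ∀ k i → (const q̂ ^ k) 0 i ≡ nq (δ k i)
  q̂^-0 zero    zero    = refl
  q̂^-0 zero    (suc i) = refl
  q̂^-0 (suc k) zero    = 𝒫.𝕏-⊠-zero ((const q̂ ^ k) 0)
  q̂^-0 (suc k) (suc i) = trans (𝒫.𝕏-⊠-suc ((const q̂ ^ k) 0) i) (q̂^-0 k i)

  value-at : ∀ i m → Value.value m i ≡ nq (qCoefficient i m)
  value-at i (W^ a X^ b Y^ zero  Z^ d) = q̂^-0 ⌊ d /2⌋ i
  value-at i (W^ a X^ b Y^ suc c Z^ d) = refl

  valueSum-at : ∀ i L → Value.valueSum L i ≡ nq (qCoefficientSum i L)
  valueSum-at i []      = refl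
  valueSum-at i (m ∷ L) = trans (cong₂ _+_ (value-at i m) (valueSum-at i L)) (sym (nq-+ (qCoefficient i m) (qCoefficientSum i L)))

  open Twist ℚ[[q]] using (sign)
  open import Algebra.Properties.Semiring.Mult (CommutativeRing.semiring ℚ-ring) using (_×_)
  open import Data.Bool using (true; false; if_then_else_)
  open import Data.Parity.Base using (0ℙ; 1ℙ; _⁻¹)
  open import Data.Nat using (parity)

  sign≈sgn : ∀ k → sign k ≈ 𝒫.const (sgn k)
  sign≈sgn zero    = 𝒫R.refl
  sign≈sgn (suc k) = 𝒫R.trans (𝒫R.*-cong (𝒫R.refl {𝒫R.- 1#}) (sign≈sgn k))
                              (𝒫R.trans (-1*x≈-x (𝒫.const (sgn k))) (𝒫.coeffwise λ { zero → refl ; (suc m) → refl }))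
    where open import Algebra.Properties.Ring 𝒫R.ring using (-1*x≈-x)

  sign-⊛ : ∀ k f i → (sign k ⊛ f) i ≡ sgn k * f i
  sign-⊛ k f i = trans (𝒫.coeff (𝒫R.*-cong (sign≈sgn k) (𝒫R.refl {f})) i) (𝒫.const-⊠ (sgn k) f i)

  parity≡isOdd : ∀ n → parity n ≡ (if isOdd n then 1ℙ else 0ℙ)
  parity≡isOdd zero    = refl
  parity≡isOdd (suc n) with isOdd n | parity≡isOdd n
  ... | true  | p≡1 = trans (parity-suc n) (cong _⁻¹ p≡1)
  ... | false | p≡0 = trans (parity-suc n) (cong _⁻¹ p≡0)

  J≡n!W : ∀ n i → J n i ≡ ((n !) 𝒫.×ₛ Jac.W n) i
  J≡n!W n i = sym (begin
    ((n !) 𝒫.×ₛ Jac.W n) i                                           ≡⟨ 𝒫.×ₛ-coeff (n !) (Jac.W n) i ⟩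
    (n !) × Jac.W n i                                                ≡⟨ ×≡nq* (n !) _ ⟩
    nq (n !) * ((sign ⌊ n /2⌋ ⊛ Jac.cn n) i + (sign ⌊ n /2⌋ ⊛ Jac.sn n) i)
      ≡⟨ cong (nq (n !) *_) (cong₂ _+_ (trans (sign-⊛ ⌊ n /2⌋ (Jac.cn n) i) (cong (sgn ⌊ n /2⌋ *_) (sym (𝒫.coeff (coeff cnS≋cn n) i))))
                                       (trans (sign-⊛ ⌊ n /2⌋ (Jac.sn n) i) (cong (sgn ⌊ n /2⌋ *_) (sym (𝒫.coeff (coeff snS≋inverse n) i))))) ⟩
    nq (n !) * (sgn ⌊ n /2⌋ * cnS n i + sgn ⌊ n /2⌋ * snS n i)      ≡⟨ choose (isOdd n) (parity≡isOdd n) ⟩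
    J n i                                                           ∎)
    where
    open ≡.≡-Reasoning
    open RingSolver ℚ-ring
    N s C S′ : ℚ
    N  = nq (n !)
    s  = sgn ⌊ n /2⌋
    C  = cnS n i
    S′ = snS n i
    choose : ∀ b → parity n ≡ (if b then 1ℙ else 0ℙ) → N * (s * C + s * S′) ≡ s * (N * (if b then S′ else C))
    choose true  odd  = trans (cong (λ x → N * (s * x + s * S′)) C≡0)
                              (solve 3 (λ N s S → N :* (s :* con (+ 0) :+ s :* S) := s :* (N :* S)) refl N s S′)
      where
      C≡0 : C ≡ 0ℚ
      C≡0 = trans (𝒫.coeff (coeff cnS≋cn n) i) (𝒫.coeff (Jac.root-even 1# n odd) i)
    choose false even = trans (cong (λ x → N * (s * C + s * x)) S≡0)
                              (solve 3 (λ N s C → N :* (s :* C :+ s :* con (+ 0)) := s :* (N :* C)) refl N s C)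
      where
      S≡0 : S′ ≡ 0ℚ
      S≡0 = trans (𝒫.coeff (coeff snS≋inverse n) i) (𝒫.coeff (Jac.sn-odd n even) i)

module PolynomialBridge where
  open import Defs
  open import Data.Rational using (_+_; _*_)
  open import Relation.Binary.PropositionalEquality using (_≡_; refl; cong; cong₂; sym; trans)
  open RationalFacts using (nq-+; nq-*)
  open MonomialCounting

  D-nq : ∀ {p p′} → (∀ a b c d → p a b c d ≡ nq (p′ a b c d)) → ∀ a b c d → D p a b c d ≡ nq (Dℕ p′ a b c d)
  D-nq {p} {p′} p≡p′ a b c d = sym (begin
    nq (Dℕ p′ a b c d)
      ≡⟨ nq-+ (dWℕ p′ a b c d) _ ⟩
    nq (dWℕ p′ a b c d) + nq (dXℕ p′ a b c d ℕ.+ (dYℕ p′ a b c d ℕ.+ dZℕ p′ a b c d))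
      ≡⟨ cong (λ r → nq (dWℕ p′ a b c d) + r) (trans (nq-+ (dXℕ p′ a b c d) _) (cong (λ r → nq (dXℕ p′ a b c d) + r) (nq-+ (dYℕ p′ a b c d) _))) ⟩
    nq (dWℕ p′ a b c d) + (nq (dXℕ p′ a b c d) + (nq (dYℕ p′ a b c d) + nq (dZℕ p′ a b c d)))
      ≡⟨ cong₂ _+_ (w b) (cong₂ _+_ (x b c d) (cong₂ _+_ (y b c d) (z b c d))) ⟩
    D p a b c d ∎)
    where
    open ≡.≡-Reasoning
    scale : ∀ k a b c d → nq (k ℕ.* p′ a b c d) ≡ nq k * p a b c d
    scale k a b c d = trans (nq-* k _) (cong (nq k *_) (sym (p≡p′ a b c d)))
    w : ∀ b → nq (dWℕ p′ a b c d) ≡ dW p a b c d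
    w zero    = refl
    w (suc b) = scale a a b c d
    x : ∀ b c d → nq (dXℕ p′ a b c d) ≡ dX p a b c d
    x b zero    d       = refl
    x b (suc c) zero    = refl
    x b (suc c) (suc d) = scale (suc b) a (suc b) c d
    y : ∀ b c d → nq (dYℕ p′ a b c d) ≡ dY p a b c d
    y zero    c d       = refl
    y (suc b) c zero    = refl
    y (suc b) c (suc d) = scale (suc c) a b (suc c) d
    z : ∀ b c d → nq (dZℕ p′ a b c d) ≡ dZ p a b c d
    z zero    c       d = refl
    z (suc b) zero    d = refl
    z (suc b) (suc c) d = scale (suc d) a b c (suc d)

  Dpow≡count : ∀ n a b c d → Dpow n Wpoly a b c d ≡ nq (count (Dⁿ[W] n) a b c d)
  Dpow≡count zero    a b c d = W≡count a b c d
    where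
    W≡count : ∀ a b c d → Wpoly a b c d ≡ nq (count (Dⁿ[W] 0) a b c d)
    W≡count zero                b       c       d       = refl
    W≡count (suc zero)          zero    zero    zero    = refl
    W≡count (suc zero)          zero    zero    (suc d) = refl
    W≡count (suc zero)          zero    (suc c) d       = refl
    W≡count (suc zero)          (suc b) c       d       = refl
    W≡count (suc (suc a))       b       c       d       = refl
  Dpow≡count (suc n) a b c d = trans (D-nq (Dpow≡count n) a b c d) (cong nq (Dℕ-count (Dⁿ[W] n) a b c d))

open import Defs
open import Data.Nat using (_*_)
open import Relation.Binary.PropositionalEquality using (_≡_)

module Exponents where
  open import Data.Nat as ℕ using (suc)
  open import Data.Nat.Properties using (*-distribˡ-∸; +-∸-assoc; m∸[m∸n]≡n; *-monoʳ-≤; ⌊n/2⌋-mono; ≤-trans; m∸n≤m)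
  open import Data.Bool using (true; false; if_then_else_)
  open import Relation.Binary.PropositionalEquality using (cong; sym; trans; subst)
  open EllipticInstance using (parity≡isOdd)

  ≤⌊n/2⌋ : ∀ {n i} → 2 * i ≤ n ∸ 1 → i ≤ ⌊ n /2⌋
  ≤⌊n/2⌋ {n} {i} 2i≤n-1 = subst (_≤ ⌊ n /2⌋) (⌊2*n/2⌋≡n i) (⌊n/2⌋-mono (≤-trans 2i≤n-1 (m∸n≤m n 1)))

  X-exponent : ∀ n {i} → i ≤ ⌊ n /2⌋ →
               (if isOdd n then suc (2 * (⌊ n /2⌋ ∸ i)) else 2 * (⌊ n /2⌋ ∸ i)) ≡ n ∸ 2 * i
  X-exponent n {i} i≤h with isOdd n | parity≡isOdd n
  ... | true  | odd  = trans (cong suc (*-distribˡ-∸ 2 ⌊ n /2⌋ i))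
                             (trans (sym (+-∸-assoc 1 (*-monoʳ-≤ 2 i≤h))) (cong (_∸ 2 * i) (odd⇒≡1+2*⌊n/2⌋ odd)))
  ... | false | even = trans (*-distribˡ-∸ 2 ⌊ n /2⌋ i) (cong (_∸ 2 * i) (even⇒≡2*⌊n/2⌋ even))

  Z-exponent : ∀ n {i} → i ≤ ⌊ n /2⌋ → 2 * ⌊ n /2⌋ ∸ 2 * (⌊ n /2⌋ ∸ i) ∸ 0 ≡ 2 * i
  Z-exponent n {i} i≤h = trans (cong (2 * ⌊ n /2⌋ ∸_) (*-distribˡ-∸ 2 ⌊ n /2⌋ i)) (m∸[m∸n]≡n (*-monoʳ-≤ 2 i≤h))

open import Data.Nat using (_!)
open import Relation.Binary.PropositionalEquality using (cong; cong₂; module ≡-Reasoning)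
open EllipticInstance
open PolynomialBridge
open MonomialCounting
open Exponents

theorem4p5 : (n i : ℕ) → 1 ≤ n → 2 * i ≤ n ∸ 1 →
    J n i ≡ t n (⌊ n /2⌋ ∸ i) 0
theorem4p5 n i _ 2i≤n-1 = begin
  J n i                                              ≡⟨ J≡n!W n i ⟩
  ((n !) 𝒫.×ₛ Jac.W n) i                              ≡⟨ 𝒫.coeff (Value.n!W[n]≈valueSum n) i ⟩
  Value.valueSum (Dⁿ[W] n) i                         ≡⟨ valueSum-at i (Dⁿ[W] n) ⟩
  nq (qCoefficientSum i (Dⁿ[W] n))                   ≡⟨ cong nq (qCoefficientSum≡count n i (Dⁿ[W]-shape n)) ⟩
  nq (count (Dⁿ[W] n) 1 (n ∸ 2 * i) 0 (2 * i))       ≡⟨ Dpow≡count n 1 (n ∸ 2 * i) 0 (2 * i) ⟨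
  Dpow n Wpoly 1 (n ∸ 2 * i) 0 (2 * i)
    ≡⟨ cong₂ (λ b d → Dpow n Wpoly 1 b 0 d) (X-exponent n i≤h) (Z-exponent n i≤h) ⟨
  t n (⌊ n /2⌋ ∸ i) 0                                ∎
  where
  open ≡-Reasoning
  i≤h : i ≤ ⌊ n /2⌋
  i≤h = ≤⌊n/2⌋ 2i≤n-1
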